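{- Let $(G,H)$ be an instance of the edge-disjoint paths problem with $G$ a planar graph given with a fixed planar embedding. Then $(G,H)$ has a solution if and only if it has a solution in which each pair of paths crosses at most once, and in which two paths with the same extremities do not cross.
   Context: Edge-disjoint paths problem: $G$ an undirected graph (parallel edges allowed), $H$ a demand graph on a subset of $V(G)$ with requests $r:E(H)\to\mathbb{N}$; a solution is a family of pairwise edge-disjoint paths in $G$ containing, for each demand edge $f=uv$, exactly $r(f)$ paths between $u$ and $v$ (a path is a sequence of distinct consecutive edges). Two edge-disjoint paths $P_1,P_2$ cross at a vertex $v$ if there are four edges $e_1,e_2,e_3,e_4$ incident to $v$, appearing in this cyclic order around $v$ in the embedding, such that $e_1,e_3$ are consecutive in $P_1$ and $e_2,e_4$ are consecutive in $P_2$. The number of crossings between $P_1$ and $P_2$ is the number of vertices (occurrences) at which they cross. -}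

module Defs where

open import Data.Nat using (ℕ; zero; suc; _+_; _*_; _<_; _≤_; _≤ᵇ_; _<ᵇ_; _≡ᵇ_)
open import Data.Bool using (Bool; true; false; not; _∧_; _∨_; if_then_else_)
open import Data.Fin using (Fin; toℕ)
open import Data.Product using (Σ; Σ-syntax; _×_; _,_; proj₁; proj₂)
open import Data.Sum using (_⊎_)
open import Data.List using (List; []; _∷_; map; concatMap; length; lookup; allFin; upTo)
open import Data.Bool.ListAction using (all; any)
open import Data.List.Relation.Unary.Unique.Propositional using (Unique)
open import Relation.Binary.PropositionalEquality using (_≡_; _≢_)
open import Function using (_∘_)
import Data.Empty

iter : {A : Set} → (A → A) → ℕ → A → A
iter f zero x = x
iter f (suc k) x = f (iter f k x)

countB : {A : Set} → (A → Bool) → List A → ℕ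
countB p [] = 0
countB p (x ∷ xs) = (if p x then 1 else 0) + countB p xs

SamePair : {A : Set} → A × A → A × A → Set
SamePair (x , y) (a , b) = (x ≡ a × y ≡ b) ⊎ (x ≡ b × y ≡ a)

-- Finite undirected multigraphs (parallel edges and loops allowed)

record Graph : Set where
  field
    nV : ℕ
    nE : ℕ
    ends : Fin nE → Fin nV × Fin nV

module _ (G : Graph) where
  open Graph G

  -- darts = edges with an orientation; (e , false) starts at proj₁ (ends e)
  Dart : Set
  Dart = Fin nE × Bool

  rev : Dart → Dart
  rev (e , b) = (e , not b)

  tail : Dart → Fin nV
  tail (e , false) = proj₁ (ends e)
  tail (e , true) = proj₂ (ends e)

  head : Dart → Fin nV
  head d = tail (rev d)

  dartIdx : Dart → ℕ
  dartIdx (e , b) = toℕ e * 2 + (if b then 1 else 0)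

  allDarts : List Dart
  allDarts = concatMap (λ e → (e , false) ∷ (e , true) ∷ []) (allFin nE)

  _≡ᶠ_ : Fin nV → Fin nV → Bool
  u ≡ᶠ v = toℕ u ≡ᵇ toℕ v

  -- number of orbits of a map π on darts (π a permutation): count darts
  -- which have the least index in their orbit
  numOrbits : (Dart → Dart) → ℕ
  numOrbits π = countB (λ d → all (λ t → dartIdx d ≤ᵇ dartIdx (iter π t d)) (upTo (nE * 2))) allDarts

  hasDart : Fin nV → Bool
  hasDart v = any (λ d → tail d ≡ᶠ v) allDarts

  reachStep : (Fin nV → Bool) → (Fin nV → Bool)
  reachStep R w = R w ∨ any (λ d → R (tail d) ∧ (head d ≡ᶠ w)) allDarts

  reach : Fin nV → Fin nV → Bool
  reach v = iter reachStep nV (λ w → v ≡ᶠ w)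

  -- number of connected components containing at least one edge
  numComps : ℕ
  numComps = countB (λ v → hasDart v ∧ all (λ u → not ((toℕ u <ᵇ toℕ v) ∧ reach v u)) (allFin nV)) (allFin nV)

  numNonIsolated : ℕ
  numNonIsolated = countB hasDart (allFin nV)

  -- Planar embeddings as genus-0 rotation systems

  record PlanarEmbedding : Set where
    field
      rot    : Dart → Dart
      rotInv : Dart → Dart
      rot-inv₁ : ∀ d → rotInv (rot d) ≡ d
      rot-inv₂ : ∀ d → rot (rotInv d) ≡ d
      rot-tail : ∀ d → tail (rot d) ≡ tail d
      rot-trans : ∀ d d′ → tail d ≡ tail d′ → Σ[ k ∈ ℕ ] iter rot k d ≡ d′
      -- Euler's formula V - E + F = 2·(#components): genus zero
      euler : numNonIsolated + numOrbits (rot ∘ rev) ≡ 2 * numComps + nE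

  -- Walks; a path is a walk whose edges are distinct (enforced in solutions)

  data Walk : Fin nV → Fin nV → Set where
    []  : ∀ {u} → Walk u u
    cons : ∀ {u v} (d : Dart) → tail d ≡ u → Walk (head d) v → Walk u v

  walkDarts : ∀ {u v} → Walk u v → List Dart
  walkDarts [] = []
  walkDarts (cons d _ w) = d ∷ walkDarts w

  -- the pairs of consecutive edges at each intermediate vertex occurrence,
  -- given as the two darts leaving that vertex
  transitions : List Dart → List (Dart × Dart)
  transitions (d ∷ d′ ∷ ds) = (rev d , d′) ∷ transitions (d′ ∷ ds)
  transitions _ = []

  module _ (Π : PlanarEmbedding) where
    open PlanarEmbedding Π

    InCyclicOrder : Dart → Dart → Dart → Dart → Set
    InCyclicOrder e₁ e₂ e₃ e₄ =
      Σ[ i ∈ ℕ ] Σ[ j ∈ ℕ ] Σ[ k ∈ ℕ ]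
        (0 < i × i < j × j < k
         × iter rot i e₁ ≡ e₂ × iter rot j e₁ ≡ e₃ × iter rot k e₁ ≡ e₄
         × (∀ t → 0 < t → t ≤ k → iter rot t e₁ ≢ e₁))

    CrossAt : Dart × Dart → Dart × Dart → Set
    CrossAt p q = Σ[ e₁ ∈ Dart ] Σ[ e₂ ∈ Dart ] Σ[ e₃ ∈ Dart ] Σ[ e₄ ∈ Dart ]
      (SamePair (e₁ , e₃) p × SamePair (e₂ , e₄) q × InCyclicOrder e₁ e₂ e₃ e₄)

    CrossAtMostOnce : ∀ {a b c d} → Walk a b → Walk c d → Set
    CrossAtMostOnce P Q =
      (i i′ : Fin (length (transitions (walkDarts P))))
      (j j′ : Fin (length (transitions (walkDarts Q)))) →
      CrossAt (lookup (transitions (walkDarts P)) i) (lookup (transitions (walkDarts Q)) j) →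
      CrossAt (lookup (transitions (walkDarts P)) i′) (lookup (transitions (walkDarts Q)) j′) →
      i ≡ i′ × j ≡ j′

    NoCross : ∀ {a b c d} → Walk a b → Walk c d → Set
    NoCross P Q =
      (i : Fin (length (transitions (walkDarts P))))
      (j : Fin (length (transitions (walkDarts Q)))) →
      CrossAt (lookup (transitions (walkDarts P)) i) (lookup (transitions (walkDarts Q)) j) →
      Data.Empty.⊥

  record Demands : Set where
    field
      nD : ℕ
      dends : Fin nD → Fin nV × Fin nV
      req : Fin nD → ℕ

  module _ (H : Demands) where
    open Demands H

    PathIdx : Set
    PathIdx = Σ[ f ∈ Fin nD ] Fin (req f)

    Family : Set
    Family = (p : PathIdx) → Walk (proj₁ (dends (proj₁ p))) (proj₂ (dends (proj₁ p)))

    allIdx : List PathIdx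
    allIdx = concatMap (λ f → map (λ i → (f , i)) (allFin (req f))) (allFin nD)

    usedEdges : Family → List (Fin nE)
    usedEdges F = concatMap (λ p → map proj₁ (walkDarts (F p))) allIdx

    -- a solution: pairwise edge-disjoint paths (each with distinct edges)
    IsSolution : Family → Set
    IsSolution F = Unique (usedEdges F)

    HasSolution : Set
    HasSolution = Σ[ F ∈ Family ] IsSolution F

    HasNiceSolution : PlanarEmbedding → Set
    HasNiceSolution Π = Σ[ F ∈ Family ] (IsSolution F ×
      ((p q : PathIdx) → p ≢ q →
        CrossAtMostOnce Π (F p) (F q)
        × (SamePair (dends (proj₁ p)) (dends (proj₁ q)) → NoCross Π (F p) (F q))))

-- Take a solution minimising the total number of edges and then the number of crossing pairs of
-- transitions (a transition is the pair of darts through which a path passes a vertex).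
-- If two paths cross twice, either one of them visits a vertex twice and a closed walk can be
-- cut out of it, or they can exchange the segments between the two crossings (each reversed if
-- the crossings come in opposite orders); if two paths with the same ends cross, they exchange
-- the segments after the crossing (reversed if the ends are opposite). An exchange keeps the
-- edges and re-pairs the four darts at each crossing so that they no longer cross. Reading the
-- darts around a vertex as points on a circle, re-pairing two crossing chords does not increase
-- the number of crossings with any disjoint chord, so the total number of crossings drops.

module Submission where

open import Defs
open import Function.Bundles using (_⇔_)

open import Data.Bool using (Bool; true; false; _xor_)
open import Data.Bool.Properties using () renaming (_≟_ to _≟ᵇ_)
open import Data.Empty using (⊥-elim)
open import Data.Fin using (Fin; zero; suc; toℕ) renaming (_≟_ to _≟ᶠ_)
import Data.Fin.Properties as Finₚ
open import Data.List using (List; []; _∷_; _++_; [_]; map; concatMap; filter; allFin; length; lookup)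
open import Data.List.Membership.Propositional using (_∈_)
open import Data.List.Membership.Propositional.Properties using (∈-allFin; ∈-map⁺; ∈-map⁻; ∈-concatMap⁺; ∈-filter⁺)
open import Data.List.Properties using (filter-all; map-++; length-++; ++-assoc; ∷-injective; concatMap-++; map-concatMap)
open import Data.List.Relation.Binary.Permutation.Propositional using (_↭_; prep; swap; ↭-refl; ↭-trans; ↭-sym; ↭-reflexive; ↭⇒↭ₛ; module PermutationReasoning)
import Data.List.Relation.Binary.Permutation.Propositional.Properties as ↭
import Data.List.Relation.Binary.Permutation.Setoid.Properties as ↭ₛ
open import Data.List.Relation.Binary.Sublist.Propositional using (_⊆_; []; _∷ʳ_; _∷_)
import Data.List.Relation.Binary.Sublist.Propositional.Properties as ⊆
open import Data.List.Relation.Unary.All using (All; []; _∷_)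
import Data.List.Relation.Unary.All as All
import Data.List.Relation.Unary.All.Properties as Allₚ
open import Data.List.Relation.Unary.AllPairs using ([]; _∷_)
import Data.List.Relation.Unary.AllPairs.Properties as AllPairs
open import Data.List.Relation.Unary.Any using (here; there)
import Data.List.Relation.Unary.Any as Any
open import Data.List.Relation.Unary.Unique.Propositional using (Unique)
import Data.List.Relation.Unary.Unique.Propositional.Properties as Unique
open import Data.Nat using (ℕ; zero; suc; _+_; _*_; _∸_; _<_; _≤_; z≤n; s≤s; _<?_; _≤?_)
open import Data.Nat.DivMod using (_%_; _/_; m≡m%n+[m/n]*n; m%n<n)
open import Data.Nat.Induction using (<-wellFounded)
open import Data.Nat.ListAction using (sum)
open import Data.Nat.Properties
open import Data.Nat.Tactic.RingSolver using (solve-∀)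
open import Data.Product using (Σ-syntax; _×_; _,_; proj₁; proj₂)
open import Data.Product.Properties using (≡-dec)
open import Data.Product.Relation.Binary.Lex.Strict using (×-Lex; ×-wellFounded)
open import Data.Sum using (_⊎_; inj₁; inj₂)
open import Function using (_∘_; mk⇔)
open import Induction.WellFounded using (WfRec)
import Induction.WellFounded as WF
import Relation.Binary.Construct.On as On
open import Relation.Binary.Definitions using (Decidable; DecidableEquality; tri<; tri≈; tri>)
open import Relation.Binary.PropositionalEquality hiding ([_])
open import Relation.Nullary using (¬_; Dec; yes; no; does; ¬?)
open import Relation.Nullary.Decidable using (_×-dec_; _⊎-dec_; does-⇔; dec-false)

-- Chords of a circle

Between : ℕ → ℕ → ℕ → Set
Between a c z = (a < z × z < c) ⊎ (c < z × z < a)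

Outside : ℕ → ℕ → ℕ → Set
Outside a c z = (z < a × z < c) ⊎ (a < z × c < z)

-- Points of a circle are labelled by ℕ along it; the chords {a, c} and {b, d} cross.
Interleave : ℕ → ℕ → ℕ → ℕ → Set
Interleave a c b d = (Between a c b × Outside a c d) ⊎ (Between a c d × Outside a c b)

-- abstract: `with` on these decisions must also abstract the Booleans they compute
abstract
  between? : ∀ a c z → Dec (Between a c z)
  between? a c z = (a <? z ×-dec z <? c) ⊎-dec (c <? z ×-dec z <? a)

  outside? : ∀ a c z → Dec (Outside a c z)
  outside? a c z = (z <? a ×-dec z <? c) ⊎-dec (a <? z ×-dec c <? z)

  interleave? : ∀ a c b d → Dec (Interleave a c b d)
  interleave? a c b d = (between? a c b ×-dec outside? a c d) ⊎-dec (between? a c d ×-dec outside? a c b)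

between-comm : ∀ {a c z} → Between a c z → Between c a z
between-comm (inj₁ p) = inj₂ p
between-comm (inj₂ p) = inj₁ p

outside-comm : ∀ {a c z} → Outside a c z → Outside c a z
outside-comm (inj₁ (p , q)) = inj₁ (q , p)
outside-comm (inj₂ (p , q)) = inj₂ (q , p)

between⇒¬outside : ∀ {a c z} → Between a c z → ¬ Outside a c z
between⇒¬outside (inj₁ (p , _)) (inj₁ (q , _)) = <-asym p q
between⇒¬outside (inj₁ (_ , p)) (inj₂ (_ , q)) = <-asym p q
between⇒¬outside (inj₂ (p , _)) (inj₁ (_ , q)) = <-asym p q
between⇒¬outside (inj₂ (_ , p)) (inj₂ (q , _)) = <-asym p q

¬between⇒outside : ∀ {a c z} → z ≢ a → z ≢ c → ¬ Between a c z → Outside a c z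
¬between⇒outside {a} {c} {z} z≢a z≢c ¬btw with <-cmp z a | <-cmp z c
... | tri≈ _ z≡a _ | _            = ⊥-elim (z≢a z≡a)
... | _            | tri≈ _ z≡c _ = ⊥-elim (z≢c z≡c)
... | tri< z<a _ _ | tri< z<c _ _ = inj₁ (z<a , z<c)
... | tri> _ _ a<z | tri> _ _ c<z = inj₂ (a<z , c<z)
... | tri< z<a _ _ | tri> _ _ c<z = ⊥-elim (¬btw (inj₂ (c<z , z<a)))
... | tri> _ _ a<z | tri< z<c _ _ = ⊥-elim (¬btw (inj₁ (a<z , z<c)))

between-convex : ∀ {a c x y z} → Between a c x → Between a c y → x < z → z < y → Between a c z
between-convex (inj₁ (a<x , _)) (inj₁ (_ , y<c)) x<z z<y = inj₁ (<-trans a<x x<z , <-trans z<y y<c)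
between-convex (inj₂ (c<x , _)) (inj₂ (_ , y<a)) x<z z<y = inj₂ (<-trans c<x x<z , <-trans z<y y<a)
between-convex (inj₁ (a<x , _)) (inj₂ (_ , y<a)) x<z z<y = ⊥-elim (<-irrefl refl (<-trans a<x (<-trans x<z (<-trans z<y y<a))))
between-convex (inj₂ (c<x , _)) (inj₁ (_ , y<c)) x<z z<y = ⊥-elim (<-irrefl refl (<-trans c<x (<-trans x<z (<-trans z<y y<c))))

interleave-commˡ : ∀ {a c b d} → Interleave a c b d → Interleave c a b d
interleave-commˡ (inj₁ (p , q)) = inj₁ (between-comm p , outside-comm q)
interleave-commˡ (inj₂ (p , q)) = inj₂ (between-comm p , outside-comm q)

interleave-commʳ : ∀ {a c b d} → Interleave a c b d → Interleave a c d b
interleave-commʳ (inj₁ p) = inj₂ p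
interleave-commʳ (inj₂ p) = inj₁ p

-- Up to the symmetries above, two crossing chords are a < b < c with d outside [a, c].
interleave-elim : (Q : ℕ → ℕ → ℕ → ℕ → Set) →
  (∀ {a c b d} → Q a c b d → Q c a b d) →
  (∀ {a c b d} → Q a c b d → Q a c d b) →
  (∀ {a b c d} → a < b → b < c → d < a ⊎ c < d → Q a c b d) →
  ∀ {a c b d} → Interleave a c b d → Q a c b d
interleave-elim Q commˡ commʳ base (inj₁ p) = normal p
  where
  normal : ∀ {a c b d} → Between a c b × Outside a c d → Q a c b d
  normal (inj₁ (a<b , b<c) , inj₁ (d<a , _)) = base a<b b<c (inj₁ d<a)
  normal (inj₁ (a<b , b<c) , inj₂ (_ , c<d)) = base a<b b<c (inj₂ c<d)
  normal (inj₂ (c<b , b<a) , inj₁ (_ , d<c)) = commˡ (base c<b b<a (inj₁ d<c))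
  normal (inj₂ (c<b , b<a) , inj₂ (a<d , _)) = commˡ (base c<b b<a (inj₂ a<d))
interleave-elim Q commˡ commʳ base (inj₂ p) = commʳ (interleave-elim Q commˡ commʳ base (inj₁ p))

interleave-sym : ∀ {a c b d} → Interleave a c b d → Interleave b d a c
interleave-sym = interleave-elim (λ a c b d → Interleave b d a c) interleave-commʳ interleave-commˡ base
  where
  base : ∀ {a b c d} → a < b → b < c → d < a ⊎ c < d → Interleave b d a c
  base a<b b<c (inj₁ d<a) = inj₁ (inj₂ (d<a , a<b) , inj₂ (b<c , <-trans (<-trans d<a a<b) b<c))
  base a<b b<c (inj₂ c<d) = inj₂ (inj₁ (b<c , c<d) , inj₁ (a<b , <-trans a<b (<-trans b<c c<d)))

Uncrossed : ℕ → ℕ → ℕ → ℕ → Set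
Uncrossed a c b d = ¬ Interleave a d b c × ¬ Interleave a b c d

interleave⇒uncrossed : ∀ {a c b d} → Interleave a c b d → Uncrossed a c b d
interleave⇒uncrossed = interleave-elim Uncrossed commˡ commʳ base
  where
  commˡ : ∀ {a c b d} → Uncrossed a c b d → Uncrossed c a b d
  commˡ (¬ad , ¬ab) = (λ x → ¬ab (interleave-commˡ (interleave-sym x))) , (λ x → ¬ad (interleave-commʳ (interleave-sym x)))
  commʳ : ∀ {a c b d} → Uncrossed a c b d → Uncrossed a c d b
  commʳ (¬ad , ¬ab) = (λ x → ¬ab (interleave-commʳ x)) , (λ x → ¬ad (interleave-commʳ x))
  ¬interleave : ∀ {a c b d} → ¬ Between a c b → ¬ Between a c d → ¬ Interleave a c b d
  ¬interleave ¬b ¬d (inj₁ (b , _)) = ¬b b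
  ¬interleave ¬b ¬d (inj₂ (d , _)) = ¬d d
  ¬interleave′ : ∀ {a c b d} → ¬ Outside a c b → ¬ Outside a c d → ¬ Interleave a c b d
  ¬interleave′ ¬b ¬d (inj₁ (_ , d)) = ¬d d
  ¬interleave′ ¬b ¬d (inj₂ (_ , b)) = ¬b b
  ¬between-above : ∀ {a c z} → a < z → c < z → ¬ Between a c z
  ¬between-above a<z c<z (inj₁ (_ , z<c)) = <-asym z<c c<z
  ¬between-above a<z c<z (inj₂ (_ , z<a)) = <-asym z<a a<z
  ¬between-below : ∀ {a c z} → z < a → z < c → ¬ Between a c z
  ¬between-below z<a z<c (inj₁ (a<z , _)) = <-asym a<z z<a
  ¬between-below z<a z<c (inj₂ (c<z , _)) = <-asym c<z z<c
  base : ∀ {a b c d} → a < b → b < c → d < a ⊎ c < d → Uncrossed a c b d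
  base a<b b<c (inj₁ d<a) =
    ¬interleave (¬between-above a<b (<-trans d<a a<b)) (¬between-above (<-trans a<b b<c) (<-trans (<-trans d<a a<b) b<c)) ,
    ¬interleave (¬between-above (<-trans a<b b<c) b<c) (¬between-below d<a (<-trans d<a a<b))
  base a<b b<c (inj₂ c<d) =
    ¬interleave′ (λ { (inj₁ (b<a , _)) → <-asym b<a a<b ; (inj₂ (_ , d<b)) → <-asym d<b (<-trans b<c c<d) })
                 (λ { (inj₁ (c<a , _)) → <-asym c<a (<-trans a<b b<c) ; (inj₂ (_ , d<c)) → <-asym d<c c<d }) ,
    ¬interleave (¬between-above (<-trans a<b b<c) b<c) (¬between-above (<-trans a<b (<-trans b<c c<d)) (<-trans b<c c<d))

¬interleave-self : ∀ {a c} → ¬ Interleave a c a c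
¬interleave-self (inj₁ (inj₁ (a<a , _) , _)) = <-irrefl refl a<a
¬interleave-self (inj₁ (inj₂ (_ , a<a) , _)) = <-irrefl refl a<a
¬interleave-self (inj₂ (inj₁ (_ , c<c) , _)) = <-irrefl refl c<c
¬interleave-self (inj₂ (inj₂ (c<c , _) , _)) = <-irrefl refl c<c

-- Positions are measured from a base point; moving the base point one step
-- along the circle of length n relabels position v by cyclicPred n v.
cyclicPred : ℕ → ℕ → ℕ
cyclicPred n zero = n ∸ 1
cyclicPred n (suc v) = v

ShiftedInterleave : ℕ → ℕ → ℕ → ℕ → ℕ → Set
ShiftedInterleave n a c b d = a < n → c < n → b < n → d < n →
  Interleave (cyclicPred n a) (cyclicPred n c) (cyclicPred n b) (cyclicPred n d)

private
  shifted-base : ∀ {n a b c d} → a < b → b < c → d < a ⊎ c < d → ShiftedInterleave n a c b d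
  shifted-base {suc m} {zero} {suc b} {suc c} {suc d} _ (s≤s b<c) (inj₂ (s≤s c<d)) _ _ _ (s≤s d<m) =
    inj₂ (inj₂ (c<d , d<m) , inj₁ (<-trans b<c (<-trans c<d d<m) , b<c))
  shifted-base {suc m} {suc a} {suc b} {suc c} {zero} (s≤s a<b) (s≤s b<c) (inj₁ _) _ (s≤s c<m) _ _ =
    inj₁ (inj₁ (a<b , b<c) , inj₂ (<-trans a<b (<-trans b<c c<m) , c<m))
  shifted-base {_} {suc a} {suc b} {suc c} {suc d} (s≤s a<b) (s≤s b<c) (inj₁ (s≤s d<a)) _ _ _ _ =
    inj₁ (inj₁ (a<b , b<c) , inj₁ (d<a , <-trans d<a (<-trans a<b b<c)))
  shifted-base {_} {suc a} {suc b} {suc c} {suc d} (s≤s a<b) (s≤s b<c) (inj₂ (s≤s c<d)) _ _ _ _ =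
    inj₁ (inj₁ (a<b , b<c) , inj₂ (<-trans a<b (<-trans b<c c<d) , c<d))
  shifted-base {_} {zero} {suc b} {suc c} {zero} _ _ (inj₂ ()) _ _ _ _
  shifted-base {_} {zero} {suc b} {suc c} {_} _ _ (inj₁ ()) _ _ _ _
  shifted-base {_} {suc a} {suc b} {suc c} {zero} _ _ (inj₂ ()) _ _ _ _
  shifted-base {_} {_} {zero} {_} {_} () _ _ _ _ _ _
  shifted-base {_} {_} {suc b} {zero} {_} _ () _ _ _ _ _
  shifted-base {zero} {_} {_} {_} {_} _ _ _ () _ _ _

interleave-cyclicPred : ∀ {n a c b d} → Interleave a c b d → ShiftedInterleave n a c b d
interleave-cyclicPred {n} = interleave-elim (ShiftedInterleave n)
  (λ q a<n c<n b<n d<n → interleave-commˡ (q c<n a<n b<n d<n))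
  (λ q a<n c<n b<n d<n → interleave-commʳ (q a<n c<n d<n b<n))
  (λ {a} {b} {c} {d} → shifted-base {n} {a} {b} {c} {d})

bit : Bool → ℕ
bit true = 1
bit false = 0

interleaveCount : ℕ → ℕ → ℕ → ℕ → ℕ
interleaveCount a c b d = bit (does (interleave? a c b d))

inside : ℕ → ℕ → ℕ → Bool
inside ξ η z = does (between? ξ η z)

interleaveCount-xor : ∀ {ξ η z w} → z ≢ ξ → z ≢ η → w ≢ ξ → w ≢ η →
  interleaveCount z w ξ η ≡ bit (inside ξ η z xor inside ξ η w)
interleaveCount-xor {ξ} {η} {z} {w} z≢ξ z≢η w≢ξ w≢η
  with between? ξ η z | between? ξ η w | interleave? z w ξ η
... | yes bz | yes bw | no _ = refl
... | yes bz | yes bw | yes x with interleave-sym x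
...   | inj₁ (_ , ow) = ⊥-elim (between⇒¬outside bw ow)
...   | inj₂ (_ , oz) = ⊥-elim (between⇒¬outside bz oz)
interleaveCount-xor z≢ξ z≢η w≢ξ w≢η | yes bz | no ¬bw | yes _ = refl
interleaveCount-xor z≢ξ z≢η w≢ξ w≢η | yes bz | no ¬bw | no ¬x =
  ⊥-elim (¬x (interleave-sym (inj₁ (bz , ¬between⇒outside w≢ξ w≢η ¬bw))))
interleaveCount-xor z≢ξ z≢η w≢ξ w≢η | no ¬bz | yes bw | yes _ = refl
interleaveCount-xor z≢ξ z≢η w≢ξ w≢η | no ¬bz | yes bw | no ¬x =
  ⊥-elim (¬x (interleave-sym (inj₂ (bw , ¬between⇒outside z≢ξ z≢η ¬bz))))
interleaveCount-xor z≢ξ z≢η w≢ξ w≢η | no ¬bz | no ¬bw | no _ = refl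
interleaveCount-xor z≢ξ z≢η w≢ξ w≢η | no ¬bz | no ¬bw | yes x with interleave-sym x
...   | inj₁ (bz , _) = ⊥-elim (¬bz bz)
...   | inj₂ (bw , _) = ⊥-elim (¬bw bw)

-- The chord {ξ, η} has a and c on one side and b and d on the other.
Separates : ℕ → ℕ → ℕ → ℕ → ℕ → ℕ → Set
Separates ξ η a c b d = inside ξ η a ≡ inside ξ η c × inside ξ η b ≡ inside ξ η d × inside ξ η a ≢ inside ξ η b

interleave⇒¬separates : ∀ {ξ η a c b d} → Interleave a c b d → ¬ Separates ξ η a c b d
interleave⇒¬separates {ξ} {η} = interleave-elim (λ a c b d → ¬ Separates ξ η a c b d)
  (λ ¬s (ac , bd , ab) → ¬s (sym ac , bd , λ cb → ab (trans ac cb)))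
  (λ ¬s (ac , bd , ab) → ¬s (ac , sym bd , λ ad → ab (trans ad (sym bd))))
  (λ {a} {b} {c} {d} → base {a} {b} {c} {d})
  where
  base : ∀ {a b c d} → a < b → b < c → d < a ⊎ c < d → ¬ Separates ξ η a c b d
  base {a} {b} {c} {d} a<b b<c d-out
    with between? ξ η a | between? ξ η b | between? ξ η c | between? ξ η d
  ... | yes _  | yes _  | _      | _      = λ (_ , _ , ab) → ab refl
  ... | no _   | no _   | _      | _      = λ (_ , _ , ab) → ab refl
  ... | yes ba | no ¬bb | yes bc | _      = λ _ → ¬bb (between-convex ba bc a<b b<c)
  ... | yes _  | no _   | no _   | _      = λ ()
  ... | no _   | yes _  | yes _  | _      = λ ()
  ... | no _   | yes _  | no _   | no _   = λ ()
  ... | no ¬ba | yes bb | no ¬bc | yes bd with d-out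
  ...   | inj₁ d<a = λ _ → ¬ba (between-convex bd bb d<a a<b)
  ...   | inj₂ c<d = λ _ → ¬bc (between-convex bb bd b<c c<d)

bit-xor-exchange : ∀ x y z w → ¬ (x ≡ z × y ≡ w × x ≢ y) →
  bit (x xor w) + bit (y xor z) ≤ bit (x xor z) + bit (y xor w)
bit-xor-exchange true  false true  false h = ⊥-elim (h (refl , refl , λ ()))
bit-xor-exchange false true  false true  h = ⊥-elim (h (refl , refl , λ ()))
bit-xor-exchange true  true  true  true  _ = z≤n
bit-xor-exchange true  true  true  false _ = s≤s z≤n
bit-xor-exchange true  true  false true  _ = s≤s z≤n
bit-xor-exchange true  true  false false _ = ≤-refl
bit-xor-exchange true  false true  true  _ = s≤s z≤n
bit-xor-exchange true  false false true  _ = z≤n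
bit-xor-exchange true  false false false _ = ≤-refl
bit-xor-exchange false true  true  true  _ = ≤-refl
bit-xor-exchange false true  true  false _ = z≤n
bit-xor-exchange false true  false false _ = s≤s z≤n
bit-xor-exchange false false true  true  _ = ≤-refl
bit-xor-exchange false false true  false _ = s≤s z≤n
bit-xor-exchange false false false true  _ = s≤s z≤n
bit-xor-exchange false false false false _ = z≤n

interleaveCount-uncross : ∀ {ξ η a c b d} → Interleave a c b d →
  a ≢ ξ → a ≢ η → b ≢ ξ → b ≢ η → c ≢ ξ → c ≢ η → d ≢ ξ → d ≢ η →
  interleaveCount a d ξ η + interleaveCount b c ξ η ≤ interleaveCount a c ξ η + interleaveCount b d ξ η
interleaveCount-uncross {ξ} {η} {a} {c} {b} {d} x a≢ξ a≢η b≢ξ b≢η c≢ξ c≢η d≢ξ d≢η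
  rewrite interleaveCount-xor a≢ξ a≢η d≢ξ d≢η | interleaveCount-xor b≢ξ b≢η c≢ξ c≢η
        | interleaveCount-xor a≢ξ a≢η c≢ξ c≢η | interleaveCount-xor b≢ξ b≢η d≢ξ d≢η
  = bit-xor-exchange (inside ξ η a) (inside ξ η b) (inside ξ η c) (inside ξ η d) (interleave⇒¬separates x)

-- The rotation around a vertex

-- the least t < n with P t, or n if there is none
minimise : {P : ℕ → Set} → (∀ t → Dec (P t)) → ℕ → ℕ
minimise P? zero = zero
minimise P? (suc n) with P? 0
... | yes _ = 0
... | no _ = suc (minimise (P? ∘ suc) n)

minimise-sat : ∀ {P : ℕ → Set} (P? : ∀ t → Dec (P t)) n → minimise P? n < n → P (minimise P? n)
minimise-sat P? (suc n) lt with P? 0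
... | yes p = p
... | no _ = minimise-sat (P? ∘ suc) n (≤-pred lt)

minimise-least : ∀ {P : ℕ → Set} (P? : ∀ t → Dec (P t)) n t → t < minimise P? n → ¬ P t
minimise-least P? (suc n) t lt with P? 0
minimise-least P? (suc n) zero    lt | no ¬p = ¬p
minimise-least P? (suc n) (suc t) lt | no _  = minimise-least (P? ∘ suc) n t (≤-pred lt)

minimise-≤ : ∀ {P : ℕ → Set} (P? : ∀ t → Dec (P t)) n → minimise P? n ≤ n
minimise-≤ P? zero = z≤n
minimise-≤ P? (suc n) with P? 0
... | yes _ = z≤n
... | no _ = s≤s (minimise-≤ (P? ∘ suc) n)

minimise-≤-witness : ∀ {P : ℕ → Set} (P? : ∀ t → Dec (P t)) n t → P t → minimise P? n ≤ t
minimise-≤-witness P? n t p with minimise P? n ≤? t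
... | yes le = le
... | no ¬le = ⊥-elim (minimise-least P? n t (≰⇒> ¬le) p)

minimise-<-witness : ∀ {P : ℕ → Set} (P? : ∀ t → Dec (P t)) n t → P t → t < n → minimise P? n < n
minimise-<-witness P? n t p t<n = ≤-<-trans (minimise-≤-witness P? n t p) t<n

iter-+ : ∀ {A : Set} (f : A → A) m n x → iter f (m + n) x ≡ iter f m (iter f n x)
iter-+ f zero n x = refl
iter-+ f (suc m) n x = cong f (iter-+ f m n x)

iter-comm : ∀ {A : Set} (f : A → A) n x → iter f n (f x) ≡ f (iter f n x)
iter-comm f zero x = refl
iter-comm f (suc n) x = cong f (iter-comm f n x)

module Rotation (G : Graph) (Π : PlanarEmbedding G) where
  open Graph G
  open PlanarEmbedding Π

  _≟ᵈ_ : Decidable {A = Dart G} _≡_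
  _≟ᵈ_ = ≡-dec _≟ᶠ_ _≟ᵇ_

  rot-injective : ∀ {x y} → rot x ≡ rot y → x ≡ y
  rot-injective {x} {y} eq = trans (sym (rot-inv₁ x)) (trans (cong rotInv eq) (rot-inv₁ y))

  rot^-injective : ∀ n {x y} → iter rot n x ≡ iter rot n y → x ≡ y
  rot^-injective zero eq = eq
  rot^-injective (suc n) eq = rot^-injective n (rot-injective eq)

  tail-rot^ : ∀ n x → tail G (iter rot n x) ≡ tail G x
  tail-rot^ zero x = refl
  tail-rot^ (suc n) x = trans (rot-tail (iter rot n x)) (tail-rot^ n x)

  tail-rotInv : ∀ x → tail G x ≡ tail G (rotInv x)
  tail-rotInv x = trans (cong (tail G) (sym (rot-inv₂ x))) (rot-tail (rotInv x))

  Returns : Dart G → ℕ → Set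
  Returns x t = iter rot (suc t) x ≡ x

  returns? : ∀ x t → Dec (Returns x t)
  returns? x t = iter rot (suc t) x ≟ᵈ x

  Reaches : Dart G → Dart G → ℕ → Set
  Reaches x y t = iter rot t x ≡ y

  reaches? : ∀ x y t → Dec (Reaches x y t)
  reaches? x y t = iter rot t x ≟ᵈ y

  -- rot (rotInv x) = x, so the rotation from x to rotInv x gives a return time of x.
  returnBound : Dart G → ℕ
  returnBound x = suc (proj₁ (rot-trans x (rotInv x) (tail-rotInv x)))

  returns-before-bound : ∀ x → Σ[ t ∈ ℕ ] (Returns x t × t < returnBound x)
  returns-before-bound x with rot-trans x (rotInv x) (tail-rotInv x)
  ... | k , eq = k , trans (cong rot eq) (rot-inv₂ x) , ≤-refl

  -- the degree of the vertex of x: the length of the orbit of x under rot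
  period : Dart G → ℕ
  period x = suc (minimise (returns? x) (returnBound x))

  period-returns : ∀ x → iter rot (period x) x ≡ x
  period-returns x with returns-before-bound x
  ... | t , r , t<b = minimise-sat (returns? x) _ (minimise-<-witness (returns? x) _ t r t<b)

  period-minimal : ∀ x t → 0 < t → t < period x → iter rot t x ≢ x
  period-minimal x (suc t) _ (s≤s lt) = minimise-least (returns? x) _ t lt

  period-≤ : ∀ x t → 0 < t → iter rot t x ≡ x → period x ≤ t
  period-≤ x (suc t) _ r = s≤s (minimise-≤-witness (returns? x) _ t r)

  rot^-period-multiple : ∀ x q → iter rot (q * period x) x ≡ x
  rot^-period-multiple x zero = refl
  rot^-period-multiple x (suc q) =
    trans (iter-+ rot (period x) (q * period x) x) (trans (cong (iter rot (period x)) (rot^-period-multiple x q)) (period-returns x))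

  private
    rot^-no-return-below-period : ∀ x {s t} → s < t → t < period x → iter rot s x ≢ iter rot t x
    rot^-no-return-below-period x {s} {t} s<t t<p eq =
      period-minimal x (t ∸ s) (m<n⇒0<n∸m s<t) (≤-<-trans (m∸n≤m t s) t<p) (rot^-injective s (begin
        iter rot s (iter rot (t ∸ s) x)  ≡⟨ sym (iter-+ rot s (t ∸ s) x) ⟩
        iter rot (s + (t ∸ s)) x         ≡⟨ cong (λ m → iter rot m x) (m+[n∸m]≡n (<⇒≤ s<t)) ⟩
        iter rot t x                     ≡⟨ sym eq ⟩
        iter rot s x                     ∎))
      where open ≡-Reasoning

  rot^-injective-below-period : ∀ x {s t} → s < period x → t < period x → iter rot s x ≡ iter rot t x → s ≡ t
  rot^-injective-below-period x {s} {t} s<p t<p eq with <-cmp s t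
  ... | tri≈ _ s≡t _ = s≡t
  ... | tri< s<t _ _ = ⊥-elim (rot^-no-return-below-period x s<t t<p eq)
  ... | tri> _ _ t<s = ⊥-elim (rot^-no-return-below-period x t<s s<p (sym eq))

  period-rot : ∀ x → period (rot x) ≡ period x
  period-rot x = ≤-antisym
    (period-≤ (rot x) (period x) (s≤s z≤n) (trans (iter-comm rot (period x) x) (cong rot (period-returns x))))
    (period-≤ x (period (rot x)) (s≤s z≤n) (rot-injective (trans (sym (iter-comm rot (period (rot x)) x)) (period-returns (rot x)))))

  reach-below-period : ∀ x y → tail G x ≡ tail G y → Σ[ t ∈ ℕ ] (t < period x × iter rot t x ≡ y)
  reach-below-period x y eq with rot-trans x y eq
  ... | k , reaches = k % period x , m%n<n k (period x) , (begin
      iter rot (k % period x) x                                         ≡⟨ cong (iter rot (k % period x)) (sym (rot^-period-multiple x (k / period x))) ⟩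
      iter rot (k % period x) (iter rot (k / period x * period x) x)  ≡⟨ sym (iter-+ rot (k % period x) _ x) ⟩
      iter rot (k % period x + k / period x * period x) x              ≡⟨ cong (λ m → iter rot m x) (sym (m≡m%n+[m/n]*n k (period x))) ⟩
      iter rot k x                                                      ≡⟨ reaches ⟩
      y                                                                 ∎)
    where open ≡-Reasoning

  position : Dart G → Dart G → ℕ
  position x y = minimise (reaches? x y) (period x)

  position-< : ∀ x y → tail G x ≡ tail G y → position x y < period x
  position-< x y eq with reach-below-period x y eq
  ... | t , t<p , reaches = minimise-<-witness (reaches? x y) _ t reaches t<p

  position-reaches : ∀ x y → tail G x ≡ tail G y → iter rot (position x y) x ≡ y
  position-reaches x y eq = minimise-sat (reaches? x y) _ (position-< x y eq)

  position-unique : ∀ x y t → t < period x → iter rot t x ≡ y → position x y ≡ t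
  position-unique x y t t<p reaches = rot^-injective-below-period x (position-< x y eq) t<p
    (trans (position-reaches x y eq) (sym reaches))
    where
    eq : tail G x ≡ tail G y
    eq = trans (sym (tail-rot^ t x)) (cong (tail G) reaches)

  position-self : ∀ x → position x x ≡ 0
  position-self x = position-unique x x 0 (s≤s z≤n) refl

  position-rot : ∀ x z → tail G x ≡ tail G z → position (rot x) z ≡ cyclicPred (period x) (position x z)
  position-rot x z eq = shift (position x z) (position-< x z eq) (position-reaches x z eq)
    where
    shift : ∀ s → s < period x → iter rot s x ≡ z → position (rot x) z ≡ cyclicPred (period x) s
    shift zero _ reaches = position-unique (rot x) z (period x ∸ 1)
      (subst (period x ∸ 1 <_) (sym (period-rot x)) ≤-refl)
      (trans (iter-comm rot (period x ∸ 1) x) (trans (period-returns x) reaches))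
    shift (suc s) s<p reaches = position-unique (rot x) z s
      (subst (s <_) (sym (period-rot x)) (<-trans (n<1+n s) s<p))
      (trans (iter-comm rot s x) reaches)

-- Crossing transitions

SamePair-refl : ∀ {A : Set} {p : A × A} → SamePair p p
SamePair-refl = inj₁ (refl , refl)

SamePair-sym : ∀ {A : Set} {p q : A × A} → SamePair p q → SamePair q p
SamePair-sym (inj₁ (refl , refl)) = inj₁ (refl , refl)
SamePair-sym (inj₂ (refl , refl)) = inj₂ (refl , refl)

module Crossings (G : Graph) (Π : PlanarEmbedding G) where
  open PlanarEmbedding Π
  open Rotation G Π

  At : Fin (Graph.nV G) → Dart G → Set
  At v z = tail G z ≡ v

  AllAt : Fin (Graph.nV G) → Dart G → Dart G → Dart G → Dart G → Set
  AllAt v a c b d = At v a × At v c × At v b × At v d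

  InterleaveFrom : Dart G → Dart G → Dart G → Dart G → Dart G → Set
  InterleaveFrom y a c b d = Interleave (position y a) (position y c) (position y b) (position y d)

  private
    pos< : ∀ {v x z} → At v x → At v z → position x z < period x
    pos< x∈v z∈v = position-< _ _ (trans x∈v (sym z∈v))

  interleaveFrom-rot : ∀ {v x a c b d} → At v x → AllAt v a c b d → InterleaveFrom x a c b d → InterleaveFrom (rot x) a c b d
  interleaveFrom-rot {v} {x} {a} {c} {b} {d} x∈v (a∈v , c∈v , b∈v , d∈v) i
    rewrite position-rot x a (trans x∈v (sym a∈v)) | position-rot x c (trans x∈v (sym c∈v))
          | position-rot x b (trans x∈v (sym b∈v)) | position-rot x d (trans x∈v (sym d∈v))
    = interleave-cyclicPred i (pos< x∈v a∈v) (pos< x∈v c∈v) (pos< x∈v b∈v) (pos< x∈v d∈v)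

  interleaveFrom-rot^ : ∀ t {v x a c b d} → At v x → AllAt v a c b d → InterleaveFrom x a c b d →
    InterleaveFrom (iter rot t x) a c b d
  interleaveFrom-rot^ zero x∈v all i = i
  interleaveFrom-rot^ (suc t) {x = x} x∈v all i =
    interleaveFrom-rot (trans (tail-rot^ t x) x∈v) all (interleaveFrom-rot^ t x∈v all i)

  interleaveFrom-rebase : ∀ {v x y a c b d} → At v x → At v y → AllAt v a c b d →
    InterleaveFrom x a c b d → InterleaveFrom y a c b d
  interleaveFrom-rebase {x = x} {y} x∈v y∈v all i with reach-below-period x y (trans x∈v (sym y∈v))
  ... | t , _ , refl = interleaveFrom-rot^ t x∈v all i

  interleaveFrom⇒crossAt : ∀ a c b d → AllAt (tail G a) a c b d → InterleaveFrom a a c b d → CrossAt G Π (a , c) (b , d)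
  interleaveFrom⇒crossAt a c b d (_ , c∈v , b∈v , d∈v) i rewrite position-self a = cross i
    where
    reaches : ∀ {z} → At (tail G a) z → iter rot (position a z) a ≡ z
    reaches z∈v = position-reaches a _ (sym z∈v)
    noReturn : ∀ {z} → At (tail G a) z → ∀ t → 0 < t → t ≤ position a z → iter rot t a ≢ a
    noReturn z∈v t 0<t t≤k = period-minimal a t 0<t (≤-<-trans t≤k (pos< refl z∈v))
    cross : Interleave 0 (position a c) (position a b) (position a d) → CrossAt G Π (a , c) (b , d)
    cross (inj₁ (inj₁ (0<i , i<j) , inj₂ (_ , j<k))) =
      a , b , c , d , inj₁ (refl , refl) , inj₁ (refl , refl) ,
      _ , _ , _ , 0<i , i<j , j<k , reaches b∈v , reaches c∈v , reaches d∈v , noReturn d∈v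
    cross (inj₂ (inj₁ (0<i , i<j) , inj₂ (_ , j<k))) =
      a , d , c , b , inj₁ (refl , refl) , inj₂ (refl , refl) ,
      _ , _ , _ , 0<i , i<j , j<k , reaches d∈v , reaches c∈v , reaches b∈v , noReturn b∈v
    cross (inj₁ (inj₂ (_ , ()) , _))
    cross (inj₁ (inj₁ _ , inj₁ (() , _)))
    cross (inj₂ (inj₂ (_ , ()) , _))
    cross (inj₂ (inj₁ _ , inj₁ (() , _)))

  crossAt⇒interleaveFrom : ∀ {a c b d} → CrossAt G Π (a , c) (b , d) →
    AllAt (tail G a) a c b d × (∀ y → At (tail G a) y → InterleaveFrom y a c b d)
  crossAt⇒interleaveFrom {a} {c} {b} {d} (e₁ , e₂ , e₃ , e₄ , e₁e₃ , e₂e₄ , i , j , k , 0<i , i<j , j<k , reach₂ , reach₃ , reach₄ , noReturn)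
    = from e₁e₃ e₂e₄
    where
    k<p : k < period e₁
    k<p with k <? period e₁
    ... | yes lt = lt
    ... | no ¬lt = ⊥-elim (noReturn (period e₁) (s≤s z≤n) (≮⇒≥ ¬lt) (period-returns e₁))
    at : ∀ t {z} → iter rot t e₁ ≡ z → At (tail G e₁) z
    at t refl = tail-rot^ t e₁
    all : AllAt (tail G e₁) e₁ e₃ e₂ e₄
    all = refl , at j reach₃ , at i reach₂ , at k reach₄
    fromBase : InterleaveFrom e₁ e₁ e₃ e₂ e₄
    fromBase rewrite position-self e₁ | position-unique e₁ e₂ i (<-trans i<j (<-trans j<k k<p)) reach₂
                   | position-unique e₁ e₃ j (<-trans j<k k<p) reach₃ | position-unique e₁ e₄ k k<p reach₄
      = inj₁ (inj₁ (0<i , i<j) , inj₂ (<-trans 0<i (<-trans i<j j<k) , j<k))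
    fromAny : ∀ y → At (tail G e₁) y → InterleaveFrom y e₁ e₃ e₂ e₄
    fromAny y y∈v = interleaveFrom-rebase refl y∈v all fromBase
    e₃∈v : At (tail G e₁) e₃
    e₃∈v = at j reach₃
    from : SamePair (e₁ , e₃) (a , c) → SamePair (e₂ , e₄) (b , d) →
      AllAt (tail G a) a c b d × (∀ y → At (tail G a) y → InterleaveFrom y a c b d)
    from (inj₁ (refl , refl)) (inj₁ (refl , refl)) = all , fromAny
    from (inj₁ (refl , refl)) (inj₂ (refl , refl)) =
      (refl , at j reach₃ , at k reach₄ , at i reach₂) , λ y y∈v → interleave-commʳ (fromAny y y∈v)
    from (inj₂ (refl , refl)) (inj₁ (refl , refl)) =
      (refl , sym e₃∈v , trans (at i reach₂) (sym e₃∈v) , trans (at k reach₄) (sym e₃∈v)) ,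
      λ y y∈v → interleave-commˡ (fromAny y (trans y∈v e₃∈v))
    from (inj₂ (refl , refl)) (inj₂ (refl , refl)) =
      (refl , sym e₃∈v , trans (at k reach₄) (sym e₃∈v) , trans (at i reach₂) (sym e₃∈v)) ,
      λ y y∈v → interleave-commʳ (interleave-commˡ (fromAny y (trans y∈v e₃∈v)))

  crossAt⇒allAt : ∀ {a c b d} → CrossAt G Π (a , c) (b , d) → AllAt (tail G a) a c b d
  crossAt⇒allAt = proj₁ ∘ crossAt⇒interleaveFrom

  abstract
    crossAt? : ∀ p q → Dec (CrossAt G Π p q)
    crossAt? (a , c) (b , d) with tail G c ≟ᶠ tail G a | tail G b ≟ᶠ tail G a | tail G d ≟ᶠ tail G a
    ... | no c∉v | _ | _ = no (c∉v ∘ proj₁ ∘ proj₂ ∘ crossAt⇒allAt)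
    ... | yes _ | no b∉v | _ = no (b∉v ∘ proj₁ ∘ proj₂ ∘ proj₂ ∘ crossAt⇒allAt)
    ... | yes _ | yes _ | no d∉v = no (d∉v ∘ proj₂ ∘ proj₂ ∘ proj₂ ∘ crossAt⇒allAt)
    ... | yes c∈v | yes b∈v | yes d∈v with interleave? (position a a) (position a c) (position a b) (position a d)
    ...   | yes i = yes (interleaveFrom⇒crossAt a c b d (refl , c∈v , b∈v , d∈v) i)
    ...   | no ¬i = no (λ x → ¬i (proj₂ (crossAt⇒interleaveFrom x) a refl))

  crossAt-sym : ∀ {p q} → CrossAt G Π p q → CrossAt G Π q p
  crossAt-sym {a , c} {b , d} x with crossAt⇒interleaveFrom x
  ... | (_ , c∈v , b∈v , d∈v) , i =
    interleaveFrom⇒crossAt b d a c (refl , trans d∈v (sym b∈v) , sym b∈v , trans c∈v (sym b∈v)) (interleave-sym (i b b∈v))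

  crossAt-commˡ : ∀ {a c q} → CrossAt G Π (a , c) q → CrossAt G Π (c , a) q
  crossAt-commˡ {a} {c} {b , d} x with crossAt⇒interleaveFrom x
  ... | (_ , c∈v , b∈v , d∈v) , i =
    interleaveFrom⇒crossAt c a b d (refl , sym c∈v , trans b∈v (sym c∈v) , trans d∈v (sym c∈v)) (interleave-commˡ (i c c∈v))

  crossAt-respˡ : ∀ {p p′ q} → SamePair p p′ → CrossAt G Π p q → CrossAt G Π p′ q
  crossAt-respˡ (inj₁ (refl , refl)) x = x
  crossAt-respˡ (inj₂ (refl , refl)) x = crossAt-commˡ x

  crossAt-respʳ : ∀ {p q q′} → SamePair q q′ → CrossAt G Π p q → CrossAt G Π p q′
  crossAt-respʳ s = crossAt-sym ∘ crossAt-respˡ s ∘ crossAt-sym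

  ¬crossAt-self : ∀ {p} → ¬ CrossAt G Π p p
  ¬crossAt-self {a , c} x = ¬interleave-self (proj₂ (crossAt⇒interleaveFrom x) a refl)

  crossAt⇒same-vertex : ∀ {a c b d} → CrossAt G Π (a , c) (b , d) → tail G c ≡ tail G d
  crossAt⇒same-vertex x with crossAt⇒allAt x
  ... | _ , c∈v , _ , d∈v = trans c∈v (sym d∈v)

  Repairing : Dart G × Dart G → Dart G × Dart G → Dart G × Dart G → Dart G × Dart G → Set
  Repairing (a , c) (b , d) t₁ t₂ =
    (SamePair t₁ (a , d) × SamePair t₂ (b , c)) ⊎ (SamePair t₁ (a , b) × SamePair t₂ (c , d))

  repairing⇒¬crossAt : ∀ {s₁ s₂ t₁ t₂} → CrossAt G Π s₁ s₂ → Repairing s₁ s₂ t₁ t₂ → ¬ CrossAt G Π t₁ t₂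
  repairing⇒¬crossAt {a , c} {b , d} x r y with crossAt⇒interleaveFrom x
  ... | _ , i with r
  ...   | inj₁ (t₁ , t₂) = proj₁ (interleave⇒uncrossed (i a refl)) (proj₂ (crossAt⇒interleaveFrom (crossAt-respʳ t₂ (crossAt-respˡ t₁ y))) a refl)
  ...   | inj₂ (t₁ , t₂) = proj₂ (interleave⇒uncrossed (i a refl)) (proj₂ (crossAt⇒interleaveFrom (crossAt-respʳ t₂ (crossAt-respˡ t₁ y))) a refl)

  crossings : Dart G × Dart G → Dart G × Dart G → ℕ
  crossings p q = bit (does (crossAt? p q))

  crossings-sym : ∀ p q → crossings p q ≡ crossings q p
  crossings-sym p q = cong bit (does-⇔ (mk⇔ crossAt-sym crossAt-sym) (crossAt? p q) (crossAt? q p))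

  crossings-respˡ : ∀ {p p′} q → SamePair p p′ → crossings p q ≡ crossings p′ q
  crossings-respˡ {p} {p′} q s =
    cong bit (does-⇔ (mk⇔ (crossAt-respˡ s) (crossAt-respˡ (SamePair-sym s))) (crossAt? p q) (crossAt? p′ q))

  crossings-respʳ : ∀ p {q q′} → SamePair q q′ → crossings p q ≡ crossings p q′
  crossings-respʳ p {q} {q′} s = trans (crossings-sym p q) (trans (crossings-respˡ p s) (crossings-sym q′ p))

  crossings-crossAt : ∀ {p q} → CrossAt G Π p q → crossings p q ≡ 1
  crossings-crossAt {p} {q} x with crossAt? p q
  ... | yes _ = refl
  ... | no ¬x = ⊥-elim (¬x x)

  crossings-¬crossAt : ∀ {p q} → ¬ CrossAt G Π p q → crossings p q ≡ 0
  crossings-¬crossAt {p} {q} ¬x = cong bit (dec-false (crossAt? p q) ¬x)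

  crossings-from : ∀ {v y a c b d} → At v y → AllAt v a c b d →
    crossings (a , c) (b , d) ≡ interleaveCount (position y a) (position y c) (position y b) (position y d)
  crossings-from {v} {y} {a} {c} {b} {d} y∈v all@(a∈v , c∈v , b∈v , d∈v) = cong bit (does-⇔ (mk⇔
    (λ x → proj₂ (crossAt⇒interleaveFrom x) y (trans y∈v (sym a∈v)))
    (λ i → interleaveFrom⇒crossAt a c b d (refl , trans c∈v (sym a∈v) , trans b∈v (sym a∈v) , trans d∈v (sym a∈v))
                                    (interleaveFrom-rebase y∈v a∈v all i)))
    (crossAt? (a , c) (b , d)) (interleave? _ _ _ _))

  Apart : Dart G × Dart G → Dart G × Dart G → Set
  Apart (a , c) (ξ , η) = a ≢ ξ × a ≢ η × c ≢ ξ × c ≢ η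

  private
    position-injective : ∀ {y z w} → tail G y ≡ tail G z → tail G y ≡ tail G w → z ≢ w →
      position y z ≢ position y w
    position-injective {y} {z} {w} yz yw z≢w eq =
      z≢w (trans (sym (position-reaches y z yz)) (trans (cong (λ t → iter rot t y) eq) (position-reaches y w yw)))

    crossings-uncross : ∀ {a c b d ξ η} → CrossAt G Π (a , c) (b , d) → Apart (a , c) (ξ , η) → Apart (b , d) (ξ , η) →
      crossings (a , d) (ξ , η) + crossings (b , c) (ξ , η) ≤ crossings (a , c) (ξ , η) + crossings (b , d) (ξ , η)
    crossings-uncross {a} {c} {b} {d} {ξ} {η} x (a≢ξ , a≢η , c≢ξ , c≢η) (b≢ξ , b≢η , d≢ξ , d≢η)
      with crossAt⇒interleaveFrom x | tail G ξ ≟ᶠ tail G a | tail G η ≟ᶠ tail G a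
    ... | (_ , c∈v , b∈v , d∈v) , i | yes ξ∈v | yes η∈v
      = subst₂ _≤_
          (sym (cong₂ _+_ (crossings-from refl (refl , d∈v , ξ∈v , η∈v)) (crossings-from refl (b∈v , c∈v , ξ∈v , η∈v))))
          (sym (cong₂ _+_ (crossings-from refl (refl , c∈v , ξ∈v , η∈v)) (crossings-from refl (b∈v , d∈v , ξ∈v , η∈v))))
          (interleaveCount-uncross (i a refl)
            (≢pos refl ξ∈v a≢ξ) (≢pos refl η∈v a≢η) (≢pos b∈v ξ∈v b≢ξ) (≢pos b∈v η∈v b≢η)
            (≢pos c∈v ξ∈v c≢ξ) (≢pos c∈v η∈v c≢η) (≢pos d∈v ξ∈v d≢ξ) (≢pos d∈v η∈v d≢η))
      where
      ≢pos : ∀ {z w} → At (tail G a) z → At (tail G a) w → z ≢ w → position a z ≢ position a w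
      ≢pos z∈v w∈v = position-injective (sym z∈v) (sym w∈v)
    ... | (_ , c∈v , b∈v , d∈v) , _ | no ξ∉v | _
      rewrite crossings-¬crossAt {a , d} {ξ , η} (ξ∉v ∘ proj₁ ∘ proj₂ ∘ proj₂ ∘ crossAt⇒allAt)
            | crossings-¬crossAt {b , c} {ξ , η} (λ y → ξ∉v (trans (proj₁ (proj₂ (proj₂ (crossAt⇒allAt y)))) b∈v)) = z≤n
    ... | (_ , c∈v , b∈v , d∈v) , _ | yes _ | no η∉v
      rewrite crossings-¬crossAt {a , d} {ξ , η} (η∉v ∘ proj₂ ∘ proj₂ ∘ proj₂ ∘ crossAt⇒allAt)
            | crossings-¬crossAt {b , c} {ξ , η} (λ y → η∉v (trans (proj₂ (proj₂ (proj₂ (crossAt⇒allAt y)))) b∈v)) = z≤n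

  crossings-repairing : ∀ {s₁ s₂ t₁ t₂} r → CrossAt G Π s₁ s₂ → Repairing s₁ s₂ t₁ t₂ →
    Apart s₁ r → Apart s₂ r → crossings t₁ r + crossings t₂ r ≤ crossings s₁ r + crossings s₂ r
  crossings-repairing r x (inj₁ (t₁ , t₂)) ap₁ ap₂
    rewrite crossings-respˡ r t₁ | crossings-respˡ r t₂ = crossings-uncross x ap₁ ap₂
  crossings-repairing {a , c} {b , d} r x (inj₂ (t₁ , t₂)) ap₁ (b≢ξ , b≢η , d≢ξ , d≢η)
    rewrite crossings-respˡ r t₁ | crossings-respˡ r t₂
          | crossings-respˡ {c , d} {d , c} r (inj₂ (refl , refl)) | crossings-respˡ {b , d} {d , b} r (inj₂ (refl , refl))
    = crossings-uncross (crossAt-respʳ (inj₂ (refl , refl)) x) ap₁ (d≢ξ , d≢η , b≢ξ , b≢η)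

-- Counting crossings

Unique-resp-↭ : ∀ {A : Set} {xs ys : List A} → xs ↭ ys → Unique xs → Unique ys
Unique-resp-↭ {A} p = ↭ₛ.Unique-resp-↭ (setoid A) (↭⇒↭ₛ p)

sum-map-+ : ∀ {A : Set} (f g : A → ℕ) xs → sum (map (λ x → f x + g x) xs) ≡ sum (map f xs) + sum (map g xs)
sum-map-+ f g [] = refl
sum-map-+ f g (x ∷ xs) rewrite sum-map-+ f g xs = +-+-exchange (f x) (g x) _ _
  where
  +-+-exchange : ∀ a b c d → a + b + (c + d) ≡ a + c + (b + d)
  +-+-exchange = solve-∀

sum-map-cong : ∀ {A : Set} {f g : A → ℕ} xs → (∀ x → f x ≡ g x) → sum (map f xs) ≡ sum (map g xs)
sum-map-cong [] _ = refl
sum-map-cong (x ∷ xs) f≗g = cong₂ _+_ (f≗g x) (sum-map-cong xs f≗g)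

sum-map-mono : ∀ {A : Set} {f g : A → ℕ} {xs} → All (λ x → f x ≤ g x) xs → sum (map f xs) ≤ sum (map g xs)
sum-map-mono [] = z≤n
sum-map-mono (le ∷ les) = +-mono-≤ le (sum-map-mono les)

-- Equality of finite multisets of unordered pairs.
infix 4 _∼_
data _∼_ {A : Set} : List (A × A) → List (A × A) → Set where
  []    : [] ∼ []
  _∷_   : ∀ {x y xs ys} → SamePair x y → xs ∼ ys → (x ∷ xs) ∼ (y ∷ ys)
  ∼-swap  : ∀ x y {xs ys} → xs ∼ ys → (x ∷ y ∷ xs) ∼ (y ∷ x ∷ ys)
  ∼-trans : ∀ {xs ys zs} → xs ∼ ys → ys ∼ zs → xs ∼ zs

module _ {A : Set} where

  ∼-refl : ∀ (xs : List (A × A)) → xs ∼ xs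
  ∼-refl [] = []
  ∼-refl (x ∷ xs) = SamePair-refl ∷ ∼-refl xs

  ↭⇒∼ : ∀ {xs ys : List (A × A)} → xs ↭ ys → xs ∼ ys
  ↭⇒∼ {xs} _↭_.refl = ∼-refl xs
  ↭⇒∼ (prep x p) = SamePair-refl ∷ ↭⇒∼ p
  ↭⇒∼ (swap x y p) = ∼-swap x y (↭⇒∼ p)
  ↭⇒∼ (_↭_.trans p q) = ∼-trans (↭⇒∼ p) (↭⇒∼ q)

  ∼-++ : ∀ {xs ys us vs : List (A × A)} → xs ∼ ys → us ∼ vs → (xs ++ us) ∼ (ys ++ vs)
  ∼-++ [] q = q
  ∼-++ (s ∷ p) q = s ∷ ∼-++ p q
  ∼-++ (∼-swap x y p) q = ∼-swap x y (∼-++ p q)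
  ∼-++ {us = us} (∼-trans p p′) q = ∼-trans (∼-++ p (∼-refl us)) (∼-++ p′ q)

  sum-map-∼ : (g : A × A → ℕ) → (∀ {x y} → SamePair x y → g x ≡ g y) →
    ∀ {xs ys} → xs ∼ ys → sum (map g xs) ≡ sum (map g ys)
  sum-map-∼ g resp [] = refl
  sum-map-∼ g resp (s ∷ p) = cong₂ _+_ (resp s) (sum-map-∼ g resp p)
  sum-map-∼ g resp (∼-swap x y {xs} {ys} p) = begin
    g x + (g y + sum (map g xs)) ≡⟨ cong (λ z → g x + (g y + z)) (sum-map-∼ g resp p) ⟩
    g x + (g y + sum (map g ys)) ≡⟨ x+[y+z]≡y+[x+z] (g x) (g y) _ ⟩
    g y + (g x + sum (map g ys)) ∎
    where
    open ≡-Reasoning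
    x+[y+z]≡y+[x+z] : ∀ a b c → a + (b + c) ≡ b + (a + c)
    x+[y+z]≡y+[x+z] = solve-∀
  sum-map-∼ g resp (∼-trans p q) = trans (sum-map-∼ g resp p) (sum-map-∼ g resp q)

  endpoints : List (A × A) → List A
  endpoints [] = []
  endpoints ((x , y) ∷ ps) = x ∷ y ∷ endpoints ps

  endpoints-∼ : ∀ {xs ys} → xs ∼ ys → endpoints xs ↭ endpoints ys
  endpoints-∼ [] = ↭-refl
  endpoints-∼ (inj₁ (refl , refl) ∷ p) = prep _ (prep _ (endpoints-∼ p))
  endpoints-∼ (inj₂ (refl , refl) ∷ p) = swap _ _ (endpoints-∼ p)
  endpoints-∼ (∼-swap (a , b) (c , d) p) = ↭-trans (↭.shifts (a ∷ b ∷ []) (c ∷ d ∷ [])) (prep c (prep d (prep a (prep b (endpoints-∼ p)))))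
  endpoints-∼ (∼-trans p q) = ↭-trans (endpoints-∼ p) (endpoints-∼ q)

module Potential (G : Graph) (Π : PlanarEmbedding G) where
  open Crossings G Π

  Transition : Set
  Transition = Dart G × Dart G

  crossingsWith : Transition → List Transition → ℕ
  crossingsWith s R = sum (map (crossings s) R)

  -- twice the number of crossing pairs in T
  totalCrossings : List Transition → ℕ
  totalCrossings T = sum (map (λ s → crossingsWith s T) T)

  totalCrossings-∼ : ∀ {T T′} → T ∼ T′ → totalCrossings T ≡ totalCrossings T′
  totalCrossings-∼ {T} {T′} p = begin
    sum (map (λ s → crossingsWith s T) T)  ≡⟨ sum-map-cong T (λ s → sum-map-∼ (crossings s) (crossings-respʳ s) p) ⟩
    sum (map (λ s → crossingsWith s T′) T) ≡⟨ sum-map-∼ (λ s → crossingsWith s T′) (λ e → sum-map-cong T′ (λ r → crossings-respˡ r e)) p ⟩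
    sum (map (λ s → crossingsWith s T′) T′) ∎
    where open ≡-Reasoning

  private
    pairCrossings : Transition → Transition → ℕ
    pairCrossings x y = crossings x x + crossings x y + (crossings y x + crossings y y)

    crossingsWithPair : Transition → Transition → List Transition → ℕ
    crossingsWithPair x y R = sum (map (λ r → crossings x r + crossings y r) R)

    totalCrossings-∷∷ : ∀ x y R → totalCrossings (x ∷ y ∷ R) ≡
      pairCrossings x y + (crossingsWithPair x y R + crossingsWithPair x y R) + totalCrossings R
    totalCrossings-∷∷ x y R = begin
      (κ x x + (κ x y + crossingsWith x R)) + ((κ y x + (κ y y + crossingsWith y R)) + sum (map (λ r → κ r x + (κ r y + crossingsWith r R)) R))
        ≡⟨ cong (λ z → (κ x x + (κ x y + crossingsWith x R)) + ((κ y x + (κ y y + crossingsWith y R)) + z)) columns ⟩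
      (κ x x + (κ x y + crossingsWith x R)) + ((κ y x + (κ y y + crossingsWith y R)) + (crossingsWithPair x y R + totalCrossings R))
        ≡⟨ regroup (κ x x) (κ x y) (κ y x) (κ y y) (crossingsWith x R) (crossingsWith y R) _ _ ⟩
      pairCrossings x y + ((crossingsWith x R + crossingsWith y R) + crossingsWithPair x y R) + totalCrossings R
        ≡⟨ cong (λ z → pairCrossings x y + (z + crossingsWithPair x y R) + totalCrossings R) (sym (sum-map-+ (κ x) (κ y) R)) ⟩
      pairCrossings x y + (crossingsWithPair x y R + crossingsWithPair x y R) + totalCrossings R ∎
      where
      open ≡-Reasoning
      κ : Transition → Transition → ℕ
      κ = crossings
      regroup : ∀ a b c d e f g h → (a + (b + e)) + ((c + (d + f)) + (g + h)) ≡ a + b + (c + d) + ((e + f) + g) + h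
      regroup = solve-∀
      columns : sum (map (λ r → κ r x + (κ r y + crossingsWith r R)) R) ≡ crossingsWithPair x y R + totalCrossings R
      columns = trans
        (sum-map-cong R (λ r → trans (sym (+-assoc (κ r x) (κ r y) _)) (cong (_+ crossingsWith r R) (cong₂ _+_ (crossings-sym r x) (crossings-sym r y)))))
        (sum-map-+ (λ r → κ x r + κ y r) (λ r → crossingsWith r R) R)

    unique-endpoints⇒apart : ∀ {s₁ s₂} R → Unique (endpoints (s₁ ∷ s₂ ∷ R)) → All (λ r → Apart s₁ r × Apart s₂ r) R
    unique-endpoints⇒apart R ((_ ∷ _ ∷ _ ∷ a≢) ∷ (_ ∷ _ ∷ c≢) ∷ (_ ∷ b≢) ∷ d≢ ∷ _) = go R a≢ c≢ b≢ d≢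
      where
      go : ∀ {a c b d} R → All (a ≢_) (endpoints R) → All (c ≢_) (endpoints R) → All (b ≢_) (endpoints R) → All (d ≢_) (endpoints R) →
        All (λ r → Apart (a , c) r × Apart (b , d) r) R
      go [] _ _ _ _ = []
      go (r ∷ R) (aξ ∷ aη ∷ a≢) (cξ ∷ cη ∷ c≢) (bξ ∷ bη ∷ b≢) (dξ ∷ dη ∷ d≢) =
        ((aξ , aη , cξ , cη) , (bξ , bη , dξ , dη)) ∷ go R a≢ c≢ b≢ d≢

  totalCrossings-repairing : ∀ {s₁ s₂ t₁ t₂} R → CrossAt G Π s₁ s₂ → Repairing s₁ s₂ t₁ t₂ →
    Unique (endpoints (s₁ ∷ s₂ ∷ R)) → totalCrossings (t₁ ∷ t₂ ∷ R) < totalCrossings (s₁ ∷ s₂ ∷ R)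
  totalCrossings-repairing {s₁} {s₂} {t₁} {t₂} R x rep u
    rewrite totalCrossings-∷∷ t₁ t₂ R | totalCrossings-∷∷ s₁ s₂ R
    = +-monoˡ-< (totalCrossings R) (begin-strict
        pairCrossings t₁ t₂ + (crossingsWithPair t₁ t₂ R + crossingsWithPair t₁ t₂ R) ≡⟨ cong (_+ (crossingsWithPair t₁ t₂ R + crossingsWithPair t₁ t₂ R)) repaired-uncrossed ⟩
        0 + (crossingsWithPair t₁ t₂ R + crossingsWithPair t₁ t₂ R)                   <⟨ +-mono-<-≤ crossed (+-mono-≤ fewer fewer) ⟩
        pairCrossings s₁ s₂ + (crossingsWithPair s₁ s₂ R + crossingsWithPair s₁ s₂ R) ∎)
    where
    open ≤-Reasoning
    t₁⋈̸t₂ : ¬ CrossAt G Π t₁ t₂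
    t₁⋈̸t₂ = repairing⇒¬crossAt x rep
    repaired-uncrossed : pairCrossings t₁ t₂ ≡ 0
    repaired-uncrossed
      rewrite crossings-¬crossAt (¬crossAt-self {t₁}) | crossings-¬crossAt t₁⋈̸t₂
            | crossings-¬crossAt (t₁⋈̸t₂ ∘ crossAt-sym) | crossings-¬crossAt (¬crossAt-self {t₂}) = refl
    crossed : 0 < pairCrossings s₁ s₂
    crossed rewrite crossings-crossAt x = ≤-trans (m≤n+m 1 (crossings s₁ s₁)) (m≤m+n _ _)
    fewer : crossingsWithPair t₁ t₂ R ≤ crossingsWithPair s₁ s₂ R
    fewer = sum-map-mono (All.map (λ {r} (ap₁ , ap₂) → crossings-repairing r x rep ap₁ ap₂) (unique-endpoints⇒apart R u))

  endpoints-repairing : ∀ {s₁ s₂ t₁ t₂} R → Repairing s₁ s₂ t₁ t₂ → endpoints (t₁ ∷ t₂ ∷ R) ↭ endpoints (s₁ ∷ s₂ ∷ R)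
  endpoints-repairing {a , c} {b , d} R (inj₁ (t₁ , t₂)) =
    ↭-trans (endpoints-∼ (t₁ ∷ t₂ ∷ ∼-refl R)) (prep a (↭-trans (swap d b ↭-refl) (↭-trans (prep b (swap d c ↭-refl)) (swap b c ↭-refl))))
  endpoints-repairing {a , c} {b , d} R (inj₂ (t₁ , t₂)) =
    ↭-trans (endpoints-∼ (t₁ ∷ t₂ ∷ ∼-refl R)) (prep a (swap b c ↭-refl))

  totalCrossings-repairing₂ : ∀ {s₁ s₂ s₃ s₄ t₁ t₂ t₃ t₄} R →
    CrossAt G Π s₁ s₂ → Repairing s₁ s₂ t₁ t₂ → CrossAt G Π s₃ s₄ → Repairing s₃ s₄ t₃ t₄ →
    Unique (endpoints (s₁ ∷ s₂ ∷ s₃ ∷ s₄ ∷ R)) → totalCrossings (t₁ ∷ t₂ ∷ t₃ ∷ t₄ ∷ R) < totalCrossings (s₁ ∷ s₂ ∷ s₃ ∷ s₄ ∷ R)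
  totalCrossings-repairing₂ {s₁} {s₂} {s₃} {s₄} {t₁} {t₂} {t₃} {t₄} R x₁₂ r₁₂ x₃₄ r₃₄ u = begin-strict
    totalCrossings (t₁ ∷ t₂ ∷ t₃ ∷ t₄ ∷ R) ≡⟨ totalCrossings-∼ (↭⇒∼ (↭.shifts (t₁ ∷ t₂ ∷ []) (t₃ ∷ t₄ ∷ []) {R})) ⟩
    totalCrossings (t₃ ∷ t₄ ∷ t₁ ∷ t₂ ∷ R) <⟨ totalCrossings-repairing (t₁ ∷ t₂ ∷ R) x₃₄ r₃₄ u′ ⟩
    totalCrossings (s₃ ∷ s₄ ∷ t₁ ∷ t₂ ∷ R) ≡⟨ totalCrossings-∼ (↭⇒∼ (↭.shifts (s₃ ∷ s₄ ∷ []) (t₁ ∷ t₂ ∷ []) {R})) ⟩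
    totalCrossings (t₁ ∷ t₂ ∷ s₃ ∷ s₄ ∷ R) <⟨ totalCrossings-repairing (s₃ ∷ s₄ ∷ R) x₁₂ r₁₂ u ⟩
    totalCrossings (s₁ ∷ s₂ ∷ s₃ ∷ s₄ ∷ R) ∎
    where
    open ≤-Reasoning
    u′ : Unique (endpoints (s₃ ∷ s₄ ∷ t₁ ∷ t₂ ∷ R))
    u′ = Unique-resp-↭ (↭-sym (↭-trans (endpoints-∼ (↭⇒∼ (↭.shifts (s₃ ∷ s₄ ∷ []) (t₁ ∷ t₂ ∷ []) {R})))
                                       (endpoints-repairing (s₃ ∷ s₄ ∷ R) r₁₂))) u

  -- old: crossing pairs of transitions at one or two vertices; new: their repairings
  data Uncrossing : List Transition → List Transition → Set where
    once  : ∀ {s₁ s₂ t₁ t₂} → CrossAt G Π s₁ s₂ → Repairing s₁ s₂ t₁ t₂ →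
            Uncrossing (t₁ ∷ t₂ ∷ []) (s₁ ∷ s₂ ∷ [])
    twice : ∀ {s₁ s₂ s₃ s₄ t₁ t₂ t₃ t₄} →
            CrossAt G Π s₁ s₂ → Repairing s₁ s₂ t₁ t₂ → CrossAt G Π s₃ s₄ → Repairing s₃ s₄ t₃ t₄ →
            Uncrossing (t₁ ∷ t₂ ∷ t₃ ∷ t₄ ∷ []) (s₁ ∷ s₂ ∷ s₃ ∷ s₄ ∷ [])

  totalCrossings-uncrossing : ∀ {new old} R → Uncrossing new old → Unique (endpoints (old ++ R)) →
    totalCrossings (new ++ R) < totalCrossings (old ++ R)
  totalCrossings-uncrossing R (once x r) = totalCrossings-repairing R x r
  totalCrossings-uncrossing R (twice x₁₂ r₁₂ x₃₄ r₃₄) = totalCrossings-repairing₂ R x₁₂ r₁₂ x₃₄ r₃₄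

-- Walks and segments

module Walks (G : Graph) where
  open Graph G

  rev-involutive : ∀ d → rev G (rev G d) ≡ d
  rev-involutive (e , false) = refl
  rev-involutive (e , true) = refl

  rev-≢ : ∀ d → d ≢ rev G d
  rev-≢ (e , false) ()
  rev-≢ (e , true) ()

  edges : List (Dart G) → List (Fin nE)
  edges = map proj₁

  Chain : Fin nV → List (Dart G) → Fin nV → Set
  Chain u [] v = u ≡ v
  Chain u (d ∷ ds) v = tail G d ≡ u × Chain (head G d) ds v

  walk⇒chain : ∀ {u v} (w : Walk G u v) → Chain u (walkDarts G w) v
  walk⇒chain [] = refl
  walk⇒chain (cons d eq w) = eq , walk⇒chain w

  chain⇒walk : ∀ {u v} ds → Chain u ds v → Walk G u v
  chain⇒walk [] refl = []
  chain⇒walk (d ∷ ds) (eq , c) = cons d eq (chain⇒walk ds c)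

  walkDarts-chain⇒walk : ∀ {u v} ds (c : Chain u ds v) → walkDarts G (chain⇒walk ds c) ≡ ds
  walkDarts-chain⇒walk [] refl = refl
  walkDarts-chain⇒walk (d ∷ ds) (_ , c) = cong (d ∷_) (walkDarts-chain⇒walk ds c)

  Chain-++ : ∀ {u w v} xs {ys} → Chain u xs w → Chain w ys v → Chain u (xs ++ ys) v
  Chain-++ [] refl c = c
  Chain-++ (x ∷ xs) (eq , c) c′ = eq , Chain-++ xs c c′

  Chain-split : ∀ {u v} xs {ys} → Chain u (xs ++ ys) v → Σ[ w ∈ Fin nV ] (Chain u xs w × Chain w ys v)
  Chain-split [] c = _ , refl , c
  Chain-split (x ∷ xs) (eq , c) with Chain-split xs c
  ... | w , c₁ , c₂ = w , (eq , c₁) , c₂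

  Chain-resp : ∀ {u v u′ v′} xs → u ≡ u′ → v ≡ v′ → Chain u xs v → Chain u′ xs v′
  Chain-resp xs refl refl c = c

  Segment : Set
  Segment = Dart G × List (Dart G)

  darts : Segment → List (Dart G)
  darts (x , xs) = x ∷ xs

  first : Segment → Dart G
  first = proj₁

  lastOf : Dart G → List (Dart G) → Dart G
  lastOf x [] = x
  lastOf x (y ∷ ys) = lastOf y ys

  last : Segment → Dart G
  last (x , xs) = lastOf x xs

  start : Segment → Fin nV
  start m = tail G (first m)

  infixr 5 _⁀_
  _⁀_ : Segment → Segment → Segment
  (x , xs) ⁀ (y , ys) = x , (xs ++ y ∷ ys)

  junction : Segment → Segment → Dart G × Dart G
  junction m n = rev G (last m) , first n

  transitionsˢ : Segment → List (Dart G × Dart G)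
  transitionsˢ m = transitions G (darts m)

  last-⁀ : ∀ m n → last (m ⁀ n) ≡ last n
  last-⁀ (x , xs) (y , ys) = go x xs
    where
    go : ∀ x xs → lastOf x (xs ++ y ∷ ys) ≡ lastOf y ys
    go x [] = refl
    go x (z ∷ zs) = go z zs

  transitions-⁀ : ∀ m n → transitionsˢ (m ⁀ n) ≡ transitionsˢ m ++ junction m n ∷ transitionsˢ n
  transitions-⁀ (x , xs) n = go x xs
    where
    go : ∀ x xs → transitionsˢ ((x , xs) ⁀ n) ≡ transitionsˢ (x , xs) ++ junction (x , xs) n ∷ transitionsˢ n
    go x [] = refl
    go x (z ∷ zs) = cong ((rev G x , z) ∷_) (go z zs)

  transitions-⁀⁀ : ∀ m₁ m₂ m₃ →
    transitionsˢ (m₁ ⁀ m₂ ⁀ m₃) ≡ transitionsˢ m₁ ++ junction m₁ m₂ ∷ transitionsˢ m₂ ++ junction m₂ m₃ ∷ transitionsˢ m₃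
  transitions-⁀⁀ m₁ m₂ m₃ = trans (transitions-⁀ m₁ (m₂ ⁀ m₃)) (cong (λ ts → transitionsˢ m₁ ++ junction m₁ m₂ ∷ ts) (transitions-⁀ m₂ m₃))

  Chain-split⁀ : ∀ {u v} m n → Chain u (darts m ++ darts n) v → Chain u (darts m) (start n) × Chain (start n) (darts n) v
  Chain-split⁀ m n c with Chain-split (darts m) c
  ... | w , c₁ , c₂@(eq , _) = Chain-resp (darts m) refl (sym eq) c₁ , Chain-resp (darts n) (sym eq) refl c₂

  Chain-split⁀⁀ : ∀ {u v} m₁ m₂ m₃ → Chain u (darts m₁ ++ darts m₂ ++ darts m₃) v →
    Chain u (darts m₁) (start m₂) × Chain (start m₂) (darts m₂) (start m₃) × Chain (start m₃) (darts m₃) v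
  Chain-split⁀⁀ m₁ m₂ m₃ c with Chain-split⁀ m₁ (m₂ ⁀ m₃) c
  ... | c₁ , c₂₃ with Chain-split⁀ m₂ m₃ c₂₃
  ...   | c₂ , c₃ = c₁ , c₂ , c₃

  reverseOf : Dart G → List (Dart G) → Segment
  reverseOf x [] = rev G x , []
  reverseOf x (y ∷ ys) = reverseOf y ys ⁀ (rev G x , [])

  reverse : Segment → Segment
  reverse (x , xs) = reverseOf x xs

  first-reverse : ∀ m → first (reverse m) ≡ rev G (last m)
  first-reverse (x , xs) = go x xs
    where
    go : ∀ x xs → first (reverseOf x xs) ≡ rev G (lastOf x xs)
    go x [] = refl
    go x (y ∷ ys) = go y ys

  last-reverse : ∀ m → last (reverse m) ≡ rev G (first m)
  last-reverse (x , []) = refl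
  last-reverse (x , y ∷ ys) = last-⁀ (reverseOf y ys) (rev G x , [])

  Chain-reverse : ∀ {u v} m → Chain u (darts m) v → Chain v (darts (reverse m)) u
  Chain-reverse (x , xs) = go x xs
    where
    go : ∀ {u v} x xs → Chain u (x ∷ xs) v → Chain v (darts (reverseOf x xs)) u
    go x [] (refl , refl) = refl , cong (tail G) (rev-involutive x)
    go x (y ∷ ys) (refl , c) = Chain-++ (darts (reverseOf y ys)) (go y ys c) (refl , cong (tail G) (rev-involutive x))

  edges-reverse : ∀ m → edges (darts (reverse m)) ↭ edges (darts m)
  edges-reverse (x , xs) = go x xs
    where
    go : ∀ x xs → edges (darts (reverseOf x xs)) ↭ edges (x ∷ xs)
    go x [] = ↭-refl
    go x (y ∷ ys) rewrite map-++ proj₁ (darts (reverseOf y ys)) (rev G x ∷ []) =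
      ↭-trans (↭.++-comm (edges (darts (reverseOf y ys))) (proj₁ x ∷ [])) (prep (proj₁ x) (go y ys))

  transitions-reverse : ∀ m → transitionsˢ (reverse m) ∼ transitionsˢ m
  transitions-reverse (x , xs) = go x xs
    where
    go : ∀ x xs → transitionsˢ (reverseOf x xs) ∼ transitionsˢ (x , xs)
    go x [] = []
    go x (y ∷ ys) =
      subst (_∼ transitionsˢ (x , y ∷ ys)) (sym (transitions-⁀ (reverseOf y ys) (rev G x , [])))
        (∼-trans (∼-++ (go y ys) (∼-refl (junction (reverseOf y ys) (rev G x , []) ∷ [])))
          (∼-trans (↭⇒∼ (↭.++-comm (transitionsˢ (y , ys)) (junction (reverseOf y ys) (rev G x , []) ∷ [])))
            (inj₂ (trans (cong (rev G) (last-reverse (y , ys))) (rev-involutive y) , refl) ∷ ∼-refl _)))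

  cut-at : ∀ ds (i : Fin (length (transitions G ds))) →
    Σ[ m ∈ Segment ] Σ[ n ∈ Segment ] (ds ≡ darts m ++ darts n × length (darts m) ≡ suc (toℕ i) × lookup (transitions G ds) i ≡ junction m n)
  cut-at (x ∷ y ∷ zs) Fin.zero = (x , []) , (y , zs) , refl , refl , refl
  cut-at (x ∷ y ∷ zs) (Fin.suc i) with cut-at (y ∷ zs) i
  ... | m , n , eq , len , tr = (x , darts m) , n , cong (x ∷_) eq , cong suc len , tr

  private
    ++-longer : ∀ {A : Set} (xs ys xs′ ys′ : List A) → xs ++ ys ≡ xs′ ++ ys′ → length xs < length xs′ →
      Σ[ z ∈ A ] Σ[ zs ∈ List A ] (xs′ ≡ xs ++ z ∷ zs × ys ≡ z ∷ zs ++ ys′)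
    ++-longer [] ys (z ∷ zs) ys′ eq _ = z , zs , refl , eq
    ++-longer (x ∷ xs) ys (x′ ∷ xs′) ys′ eq (s≤s lt) with ∷-injective eq
    ... | refl , eq′ with ++-longer xs ys xs′ ys′ eq′ lt
    ...   | z , zs , e₁ , e₂ = z , zs , cong (x ∷_) e₁ , e₂

  cut-at₂ : ∀ ds (i i′ : Fin (length (transitions G ds))) → toℕ i < toℕ i′ →
    Σ[ m₁ ∈ Segment ] Σ[ m₂ ∈ Segment ] Σ[ m₃ ∈ Segment ]
      (ds ≡ darts m₁ ++ darts m₂ ++ darts m₃ ×
       lookup (transitions G ds) i ≡ junction m₁ m₂ × lookup (transitions G ds) i′ ≡ junction m₂ m₃)
  cut-at₂ ds i i′ i<i′ with cut-at ds i | cut-at ds i′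
  ... | m₁ , m₂₃ , eq , len , tr | m₁₂ , m₃ , eq′ , len′ , tr′
    with ++-longer (darts m₁) (darts m₂₃) (darts m₁₂) (darts m₃) (trans (sym eq) eq′) (subst₂ _<_ (sym len) (sym len′) (s≤s i<i′))
  ... | z , zs , e₁ , e₂ = m₁ , (z , zs) , m₃ , trans eq (cong (darts m₁ ++_) e₂) ,
        trans tr (cong (λ d → rev G (last m₁) , d) (proj₁ (∷-injective e₂))) ,
        trans tr′ (cong (λ d → rev G d , first m₃) (trans (cong last (segment-≡ e₁)) (last-⁀ m₁ (z , zs))))
    where
    segment-≡ : ∀ {m n} → darts m ≡ darts n → m ≡ n
    segment-≡ refl = refl

-- Families of paths

Unique-++⁻ʳ : ∀ {A : Set} (xs : List A) {ys} → Unique (xs ++ ys) → Unique ys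
Unique-++⁻ʳ [] u = u
Unique-++⁻ʳ (x ∷ xs) (_ ∷ u) = Unique-++⁻ʳ xs u

Unique-resp-⊆ : ∀ {A : Set} {xs ys : List A} → xs ⊆ ys → Unique ys → Unique xs
Unique-resp-⊆ [] u = u
Unique-resp-⊆ (y ∷ʳ sub) (_ ∷ u) = Unique-resp-⊆ sub u
Unique-resp-⊆ (refl ∷ sub) (y∉ ∷ u) = ⊆.All-resp-⊆ sub y∉ ∷ Unique-resp-⊆ sub u

concatMap-cong-All : ∀ {A B : Set} {g g′ : A → List B} {xs} → All (λ x → g x ≡ g′ x) xs → concatMap g xs ≡ concatMap g′ xs
concatMap-cong-All [] = refl
concatMap-cong-All (eq ∷ eqs) = cong₂ _++_ eq (concatMap-cong-All eqs)

module _ {A B : Set} (_≟_ : DecidableEquality A) (h : A → List B) where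

  concatMap-extract : ∀ {p xs} → Unique xs → p ∈ xs →
    concatMap h xs ↭ h p ++ concatMap h (filter (λ x → ¬? (x ≟ p)) xs)
  concatMap-extract {p} {x ∷ xs} (x∉ ∷ u) p∈ with x ≟ p | p∈
  ... | yes refl | _ rewrite filter-all (λ x → ¬? (x ≟ p)) (All.map (λ p≢x x≡p → p≢x (sym x≡p)) x∉) = ↭-refl
  ... | no x≢p | here p≡x = ⊥-elim (x≢p (sym p≡x))
  ... | no x≢p | there p∈xs =
    ↭-trans (↭.++⁺ˡ (h x) (concatMap-extract u p∈xs)) (↭.shifts (h x) (h p))

module Families (G : Graph) (H : Demands G) where
  open Walks G
  open Graph G using (nV; nE)
  open Demands H

  _≟ⁱ_ : DecidableEquality (PathIdx G H)
  _≟ⁱ_ = ≡-dec _≟ᶠ_ _≟ᶠ_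

  ∈-allIdx : ∀ p → p ∈ allIdx G H
  ∈-allIdx (f , i) = ∈-concatMap⁺ (λ g → map (g ,_) (allFin (req g))) (Any.map (λ { refl → ∈-map⁺ (f ,_) (∈-allFin i) }) (∈-allFin f))

  allIdx-unique : Unique (allIdx G H)
  allIdx-unique = Unique.concat⁺ (Allₚ.map⁺ (Allₚ.tabulate⁺ (λ f → Unique.map⁺ (λ { refl → refl }) (Unique.allFin⁺ (req f)))))
                                 (AllPairs.map⁺ (AllPairs.tabulate⁺ disjoint))
    where
    segmentOf : Fin nD → List (PathIdx G H)
    segmentOf f = map (f ,_) (allFin (req f))
    disjoint : ∀ {f g} → f ≢ g → ∀ {v} → ¬ (v ∈ segmentOf f × v ∈ segmentOf g)
    disjoint f≢g (v∈f , v∈g) with ∈-map⁻ _ v∈f | ∈-map⁻ _ v∈g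
    ... | _ , _ , refl | _ , _ , refl = f≢g refl

  source target : PathIdx G H → Fin nV
  source p = proj₁ (dends (proj₁ p))
  target p = proj₂ (dends (proj₁ p))

  dartsOf : Family G H → PathIdx G H → List (Dart G)
  dartsOf F r = walkDarts G (F r)

  update : Family G H → (p : PathIdx G H) → Walk G (source p) (target p) → Family G H
  update F p w r with r ≟ⁱ p
  ... | yes refl = w
  ... | no _ = F r

  dartsOf-update-same : ∀ F p w → dartsOf (update F p w) p ≡ walkDarts G w
  dartsOf-update-same F p w with p ≟ⁱ p
  ... | yes refl = refl
  ... | no p≢p = ⊥-elim (p≢p refl)

  dartsOf-update-other : ∀ F p w r → r ≢ p → dartsOf (update F p w) r ≡ dartsOf F r
  dartsOf-update-other F p w r r≢p with r ≟ⁱ p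
  ... | yes r≡p = ⊥-elim (r≢p r≡p)
  ... | no _ = refl

  allBut : PathIdx G H → List (PathIdx G H)
  allBut p = filter (λ r → ¬? (r ≟ⁱ p)) (allIdx G H)

  allBut₂ : PathIdx G H → PathIdx G H → List (PathIdx G H)
  allBut₂ p q = filter (λ r → ¬? (r ≟ⁱ q)) (allBut p)

  concatMap-allBut : ∀ {B : Set} (g : PathIdx G H → List B) p → concatMap g (allIdx G H) ↭ g p ++ concatMap g (allBut p)
  concatMap-allBut g p = concatMap-extract _≟ⁱ_ g allIdx-unique (∈-allIdx p)

  concatMap-allBut₂ : ∀ {B : Set} (g : PathIdx G H → List B) {p q} → q ≢ p →
    concatMap g (allIdx G H) ↭ g p ++ g q ++ concatMap g (allBut₂ p q)
  concatMap-allBut₂ g {p} {q} q≢p = ↭-trans (concatMap-allBut g p)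
    (↭.++⁺ˡ (g p) (concatMap-extract _≟ⁱ_ g (Unique.filter⁺ _ allIdx-unique) (∈-filter⁺ _ (∈-allIdx q) q≢p)))

  allBut₂-avoids : ∀ p q → All (λ r → r ≢ p × r ≢ q) (allBut₂ p q)
  allBut₂-avoids p q = All.zip (Allₚ.filter⁺ _ (Allₚ.all-filter _ (allIdx G H)) , Allₚ.all-filter _ (allBut p))

  allTransitions : Family G H → List (Dart G × Dart G)
  allTransitions F = concatMap (transitions G ∘ dartsOf F) (allIdx G H)

  bothDarts : List (Dart G) → List (Dart G)
  bothDarts = concatMap (λ d → d ∷ rev G d ∷ [])

  private
    endpoints-transitions-⊆ : ∀ ds → endpoints (transitions G ds) ⊆ bothDarts ds
    endpoints-transitions-⊆ [] = []
    endpoints-transitions-⊆ (d ∷ ds) = d ∷ʳ go d ds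
      where
      go : ∀ d ds → endpoints (transitions G (d ∷ ds)) ⊆ rev G d ∷ bothDarts ds
      go d [] = _ ∷ʳ []
      go d (d′ ∷ ds) = refl ∷ refl ∷ go d′ ds

    endpoints-++ : ∀ {A : Set} (xs ys : List (A × A)) → endpoints (xs ++ ys) ≡ endpoints xs ++ endpoints ys
    endpoints-++ [] ys = refl
    endpoints-++ ((x , y) ∷ xs) ys = cong (λ zs → x ∷ y ∷ zs) (endpoints-++ xs ys)

    endpoints-concatMap-⊆ : ∀ {C : Set} (g : C → List (Dart G)) xs →
      endpoints (concatMap (transitions G ∘ g) xs) ⊆ bothDarts (concatMap g xs)
    endpoints-concatMap-⊆ g [] = []
    endpoints-concatMap-⊆ g (x ∷ xs)
      rewrite endpoints-++ (transitions G (g x)) (concatMap (transitions G ∘ g) xs)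
            | concatMap-++ (λ d → d ∷ rev G d ∷ []) (g x) (concatMap g xs)
      = ⊆.++⁺ (endpoints-transitions-⊆ (g x)) (endpoints-concatMap-⊆ g xs)

    bothDarts-unique : ∀ ds → Unique (edges ds) → Unique (bothDarts ds)
    bothDarts-unique [] _ = []
    bothDarts-unique (d ∷ ds) (d∉ ∷ u) = (rev-≢ d ∷ apart d∉) ∷ apart d∉ ∷ bothDarts-unique ds u
      where
      apart : ∀ {z : Dart G} {ds} → All (λ e → proj₁ z ≢ e) (edges ds) → All (z ≢_) (bothDarts ds)
      apart {ds = []} [] = []
      apart {ds = d ∷ ds} (z≢d ∷ z≢) = (z≢d ∘ cong proj₁) ∷ (z≢d ∘ cong proj₁) ∷ apart z≢

  -- In a solution no dart is used twice, so no dart is an end of two transitions.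
  solution⇒endpoints-unique : ∀ F → IsSolution G H F → Unique (endpoints (allTransitions F))
  solution⇒endpoints-unique F sol = Unique-resp-⊆ (endpoints-concatMap-⊆ (dartsOf F) (allIdx G H))
    (bothDarts-unique (concatMap (dartsOf F) (allIdx G H))
      (subst Unique (sym (map-concatMap proj₁ (dartsOf F) (allIdx G H))) sol))

-- Uncrossing a solution

∼-++-assoc : ∀ {A : Set} {xs ys : List (A × A)} zs rs → xs ∼ ys ++ zs → xs ++ rs ∼ ys ++ zs ++ rs
∼-++-assoc {xs = xs} {ys} zs rs eq = subst (λ us → xs ++ rs ∼ us) (++-assoc ys zs rs) (∼-++ eq (∼-refl rs))

-- Lists under _++_ form a commutative monoid up to _↭_, so these rearrangements are solver instances.
module _ {A : Set} where
  open import Algebra.Solver.CommutativeMonoid (↭.++-commutativeMonoid {A = A})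

  pull-junctions₂ : ∀ (a₁ a₂ b₁ b₂ : List A) x y → (a₁ ++ x ∷ a₂) ++ (b₁ ++ y ∷ b₂) ↭ x ∷ y ∷ (a₁ ++ a₂) ++ (b₁ ++ b₂)
  pull-junctions₂ a₁ a₂ b₁ b₂ x y =
    solve 6 (λ a₁ a₂ b₁ b₂ x y → (a₁ ⊕ (x ⊕ a₂)) ⊕ (b₁ ⊕ (y ⊕ b₂)) ⊜ x ⊕ (y ⊕ ((a₁ ⊕ a₂) ⊕ (b₁ ⊕ b₂)))) ↭-refl
      a₁ a₂ b₁ b₂ [ x ] [ y ]

  pull-junctions₃ : ∀ (a₁ a₂ a₃ b₁ b₂ b₃ : List A) x₁ x₂ y₁ y₂ →
    (a₁ ++ x₁ ∷ a₂ ++ x₂ ∷ a₃) ++ (b₁ ++ y₁ ∷ b₂ ++ y₂ ∷ b₃) ↭ x₁ ∷ y₁ ∷ x₂ ∷ y₂ ∷ (a₁ ++ a₂ ++ a₃) ++ (b₁ ++ b₂ ++ b₃)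
  pull-junctions₃ a₁ a₂ a₃ b₁ b₂ b₃ x₁ x₂ y₁ y₂ =
    solve 10 (λ a₁ a₂ a₃ b₁ b₂ b₃ x₁ x₂ y₁ y₂ →
      (a₁ ⊕ (x₁ ⊕ (a₂ ⊕ (x₂ ⊕ a₃)))) ⊕ (b₁ ⊕ (y₁ ⊕ (b₂ ⊕ (y₂ ⊕ b₃)))) ⊜
      x₁ ⊕ (y₁ ⊕ (x₂ ⊕ (y₂ ⊕ ((a₁ ⊕ (a₂ ⊕ a₃)) ⊕ (b₁ ⊕ (b₂ ⊕ b₃))))))) ↭-refl
      a₁ a₂ a₃ b₁ b₂ b₃ [ x₁ ] [ x₂ ] [ y₁ ] [ y₂ ]

  swap-middles : ∀ (a₁ a₂ a₃ b₁ b₂ b₃ : List A) → (a₁ ++ b₂ ++ a₃) ++ (b₁ ++ a₂ ++ b₃) ↭ (a₁ ++ a₂ ++ a₃) ++ (b₁ ++ b₂ ++ b₃)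
  swap-middles = solve 6 (λ a₁ a₂ a₃ b₁ b₂ b₃ → (a₁ ⊕ (b₂ ⊕ a₃)) ⊕ (b₁ ⊕ (a₂ ⊕ b₃)) ⊜ (a₁ ⊕ (a₂ ⊕ a₃)) ⊕ (b₁ ⊕ (b₂ ⊕ b₃))) ↭-refl

  swap-tails : ∀ (a₁ a₂ b₁ b₂ : List A) → (a₁ ++ b₂) ++ (b₁ ++ a₂) ↭ (a₁ ++ a₂) ++ (b₁ ++ b₂)
  swap-tails = solve 4 (λ a₁ a₂ b₁ b₂ → (a₁ ⊕ b₂) ⊕ (b₁ ⊕ a₂) ⊜ (a₁ ⊕ a₂) ⊕ (b₁ ⊕ b₂)) ↭-refl

  swap-inner : ∀ (a₁ a₂ b₁ b₂ : List A) → (a₁ ++ b₁) ++ (a₂ ++ b₂) ↭ (a₁ ++ a₂) ++ (b₁ ++ b₂)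
  swap-inner = solve 4 (λ a₁ a₂ b₁ b₂ → (a₁ ⊕ b₁) ⊕ (a₂ ⊕ b₂) ⊜ (a₁ ⊕ a₂) ⊕ (b₁ ⊕ b₂)) ↭-refl

Fin-∀⊎ : ∀ {n} {P : Fin n → Set} {B : Set} → (∀ i → P i ⊎ B) → (∀ i → P i) ⊎ B
Fin-∀⊎ {zero} f = inj₁ λ ()
Fin-∀⊎ {suc n} {P} f with f zero | Fin-∀⊎ {P = P ∘ suc} (f ∘ suc)
... | inj₂ b  | _       = inj₂ b
... | inj₁ _  | inj₂ b  = inj₂ b
... | inj₁ p₀ | inj₁ ps = inj₁ λ { zero → p₀ ; (suc i) → ps i }

Fin-<-or-> : ∀ {n} {i j : Fin n} → i ≢ j → toℕ i < toℕ j ⊎ toℕ j < toℕ i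
Fin-<-or-> {i = i} {j} i≢j with <-cmp (toℕ i) (toℕ j)
... | tri< lt _ _ = inj₁ lt
... | tri≈ _ eq _ = ⊥-elim (i≢j (Finₚ.toℕ-injective eq))
... | tri> _ _ gt = inj₂ gt

module Improvement (G : Graph) (Π : PlanarEmbedding G) (H : Demands G) where
  open Crossings G Π
  open Potential G Π
  open Walks G
  open Families G H

  totalLength : Family G H → ℕ
  totalLength F = length (usedEdges G H F)

  measure : Family G H → ℕ × ℕ
  measure F = totalLength F , totalCrossings (allTransitions F)

  _≺_ : Family G H → Family G H → Set
  F′ ≺ F = ×-Lex _≡_ _<_ _<_ (measure F′) (measure F)

  Improvable : Family G H → Set
  Improvable F = Σ[ F′ ∈ Family G H ] (IsSolution G H F′ × F′ ≺ F)

  private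
    concatMap-update : ∀ {B : Set} (g : List (Dart G) → List B) F p w →
      concatMap (g ∘ dartsOf (update F p w)) (allIdx G H) ↭ g (walkDarts G w) ++ concatMap (g ∘ dartsOf F) (allBut p)
    concatMap-update g F p w =
      subst (λ xs → concatMap (g ∘ dartsOf F′) (allIdx G H) ↭ xs)
        (cong₂ (λ a b → g a ++ b) (dartsOf-update-same F p w)
          (concatMap-cong-All (All.map (λ r≢p → cong g (dartsOf-update-other F p w _ r≢p))
            (Allₚ.all-filter _ (allIdx G H)))))
        (concatMap-allBut (g ∘ dartsOf F′) p)
      where
      F′ : Family G H
      F′ = update F p w

    concatMap-update₂ : ∀ {B : Set} (g : List (Dart G) → List B) F {p q} (q≢p : q ≢ p) wp wq →
      concatMap (g ∘ dartsOf (update (update F p wp) q wq)) (allIdx G H)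
        ↭ g (walkDarts G wp) ++ g (walkDarts G wq) ++ concatMap (g ∘ dartsOf F) (allBut₂ p q)
    concatMap-update₂ g F {p} {q} q≢p wp wq =
      subst (λ xs → concatMap (g ∘ dartsOf F′) (allIdx G H) ↭ xs)
        (cong₂ (λ a b → g a ++ b)
          (trans (dartsOf-update-other F₁ q wq p (q≢p ∘ sym)) (dartsOf-update-same F p wp))
          (cong₂ (λ a b → g a ++ b) (dartsOf-update-same F₁ q wq)
            (concatMap-cong-All (All.map
              (λ { (r≢p , r≢q) → cong g (trans (dartsOf-update-other F₁ q wq _ r≢q) (dartsOf-update-other F p wp _ r≢p)) })
              (allBut₂-avoids p q)))))
        (concatMap-allBut₂ (g ∘ dartsOf F′) q≢p)
      where
      F₁ F′ : Family G H
      F₁ = update F p wp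
      F′ = update F₁ q wq

    E : Segment → List (Fin (Graph.nE G))
    E = edges ∘ darts

    T : Segment → List Transition
    T = transitionsˢ

    edges-++ : ∀ m n → edges (darts m ++ darts n) ≡ E m ++ E n
    edges-++ m n = map-++ proj₁ (darts m) (darts n)

    edges-++₃ : ∀ m₁ m₂ m₃ → edges (darts m₁ ++ darts m₂ ++ darts m₃) ≡ E m₁ ++ E m₂ ++ E m₃
    edges-++₃ m₁ m₂ m₃ = trans (map-++ proj₁ (darts m₁) _) (cong (E m₁ ++_) (edges-++ m₂ m₃))

    rev-last-reverse : ∀ m → rev G (last (reverse m)) ≡ first m
    rev-last-reverse m = trans (cong (rev G) (last-reverse m)) (rev-involutive (first m))

    chain-of : ∀ F p {ds} → dartsOf F p ≡ ds → Chain (source p) ds (target p)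
    chain-of F p refl = walk⇒chain (F p)

  -- p and q become P′ and Q′ on the same edges, uncrossed at one or two vertices.
  exchange : ∀ F → IsSolution G H F → ∀ {p q} → q ≢ p →
    ∀ P′ (cp : Chain (source p) P′ (target p)) Q′ (cq : Chain (source q) Q′ (target q)) →
    edges P′ ++ edges Q′ ↭ edges (dartsOf F p) ++ edges (dartsOf F q) →
    ∀ {new old X} → Uncrossing new old →
    transitions G (dartsOf F p) ++ transitions G (dartsOf F q) ∼ old ++ X →
    transitions G P′ ++ transitions G Q′ ∼ new ++ X → Improvable F
  exchange F sol {p} {q} q≢p P′ cp Q′ cq same-edges {new} {old} {X} unc old∼ new∼ =
    F′ , Unique-resp-↭ (↭-sym edges↭) sol , inj₂ (↭.↭-length edges↭ , fewer-crossings)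
    where
    wp : Walk G (source p) (target p)
    wp = chain⇒walk P′ cp
    wq : Walk G (source q) (target q)
    wq = chain⇒walk Q′ cq
    F′ : Family G H
    F′ = update (update F p wp) q wq
    edgesRest : List (Fin (Graph.nE G))
    edgesRest = concatMap (edges ∘ dartsOf F) (allBut₂ p q)
    transitionsRest : List Transition
    transitionsRest = concatMap (transitions G ∘ dartsOf F) (allBut₂ p q)
    edges↭ : usedEdges G H F′ ↭ usedEdges G H F
    edges↭ = ↭-trans (concatMap-update₂ edges F q≢p wp wq)
      (subst₂ (λ a b → edges a ++ edges b ++ edgesRest ↭ usedEdges G H F) (sym (walkDarts-chain⇒walk P′ cp)) (sym (walkDarts-chain⇒walk Q′ cq))
        (↭-trans (↭-reflexive (sym (++-assoc (edges P′) _ _)))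
          (↭-trans (↭.++⁺ʳ edgesRest same-edges)
            (↭-trans (↭-reflexive (++-assoc (edges (dartsOf F p)) _ _)) (↭-sym (concatMap-allBut₂ (edges ∘ dartsOf F) q≢p))))))
    old∼′ : allTransitions F ∼ old ++ X ++ transitionsRest
    old∼′ = ∼-trans (↭⇒∼ (↭-trans (concatMap-allBut₂ (transitions G ∘ dartsOf F) q≢p)
                                 (↭-reflexive (sym (++-assoc (transitions G (dartsOf F p)) _ transitionsRest)))))
                    (∼-++-assoc X transitionsRest old∼)
    new∼′ : allTransitions F′ ∼ new ++ X ++ transitionsRest
    new∼′ = ∼-trans (↭⇒∼ (↭-trans (concatMap-update₂ (transitions G) F q≢p wp wq)
                                 (↭-reflexive (sym (++-assoc (transitions G (walkDarts G wp)) _ transitionsRest)))))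
                    (∼-++-assoc X transitionsRest
                      (subst₂ (λ a b → transitions G a ++ transitions G b ∼ new ++ X)
                        (sym (walkDarts-chain⇒walk P′ cp)) (sym (walkDarts-chain⇒walk Q′ cq)) new∼))
    fewer-crossings : totalCrossings (allTransitions F′) < totalCrossings (allTransitions F)
    fewer-crossings = subst₂ _<_ (sym (totalCrossings-∼ new∼′)) (sym (totalCrossings-∼ old∼′))
      (totalCrossings-uncrossing (X ++ transitionsRest) unc
        (Unique-resp-↭ (endpoints-∼ old∼′) (solution⇒endpoints-unique F sol)))

  -- A walk through the same vertex twice can skip the closed walk in between.
  shortcut : ∀ F → IsSolution G H F → ∀ p m₁ m₂ m₃ → dartsOf F p ≡ darts m₁ ++ darts m₂ ++ darts m₃ →
    start m₂ ≡ start m₃ → Improvable F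
  shortcut F sol p m₁ m₂ m₃ split loop with Chain-split⁀⁀ m₁ m₂ m₃ (chain-of F p split)
  ... | c₁ , _ , c₃ = F′ , Unique-++⁻ʳ (E m₂) (Unique-resp-↭ edges↭ sol) , inj₁ shorter
    where
    ds : List (Dart G)
    ds = darts m₁ ++ darts m₃
    c : Chain (source p) ds (target p)
    c = Chain-++ (darts m₁) (Chain-resp (darts m₁) refl loop c₁) c₃
    F′ : Family G H
    F′ = update F p (chain⇒walk ds c)
    edgesRest : List (Fin (Graph.nE G))
    edgesRest = concatMap (edges ∘ dartsOf F) (allBut p)
    edges↭ : usedEdges G H F ↭ E m₂ ++ usedEdges G H F′
    edges↭ = begin
      usedEdges G H F                             ↭⟨ concatMap-allBut (edges ∘ dartsOf F) p ⟩
      edges (dartsOf F p) ++ edgesRest            ≡⟨ cong (_++ edgesRest) (trans (cong edges split) (edges-++₃ m₁ m₂ m₃)) ⟩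
      (E m₁ ++ E m₂ ++ E m₃) ++ edgesRest         ↭⟨ drop-middle (E m₁) (E m₂) (E m₃) edgesRest ⟩
      E m₂ ++ (E m₁ ++ E m₃) ++ edgesRest         ≡⟨ cong (λ es → E m₂ ++ es ++ edgesRest) (sym (edges-++ m₁ m₃)) ⟩
      E m₂ ++ edges ds ++ edgesRest               ≡⟨ cong (λ es → E m₂ ++ edges es ++ edgesRest) (sym (walkDarts-chain⇒walk ds c)) ⟩
      E m₂ ++ edges (walkDarts G (chain⇒walk ds c)) ++ edgesRest ↭⟨ ↭.++⁺ˡ (E m₂) (↭-sym (concatMap-update edges F p _)) ⟩
      E m₂ ++ usedEdges G H F′                    ∎
      where
      open PermutationReasoning
      drop-middle : ∀ (a b c r : List (Fin (Graph.nE G))) → (a ++ b ++ c) ++ r ↭ b ++ (a ++ c) ++ r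
      drop-middle = solve 4 (λ a b c r → (a ⊕ (b ⊕ c)) ⊕ r ⊜ b ⊕ ((a ⊕ c) ⊕ r)) ↭-refl
        where open import Algebra.Solver.CommutativeMonoid (↭.++-commutativeMonoid {A = Fin (Graph.nE G)})
    shorter : totalLength F′ < totalLength F
    shorter = begin-strict
      length (usedEdges G H F′)               <⟨ m<n+m _ (s≤s z≤n) ⟩
      length (E m₂) + length (usedEdges G H F′) ≡⟨ sym (length-++ (E m₂)) ⟩
      length (E m₂ ++ usedEdges G H F′)        ≡⟨ sym (↭.↭-length edges↭) ⟩
      length (usedEdges G H F)                ∎
      where open ≤-Reasoning

  -- p and q swap their segments between the two crossings.
  exchange-middles : ∀ F → IsSolution G H F → ∀ {p q} → q ≢ p → ∀ m₁ m₂ m₃ n₁ n₂ n₃ →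
    dartsOf F p ≡ darts m₁ ++ darts m₂ ++ darts m₃ → dartsOf F q ≡ darts n₁ ++ darts n₂ ++ darts n₃ →
    CrossAt G Π (junction m₁ m₂) (junction n₁ n₂) → CrossAt G Π (junction m₂ m₃) (junction n₂ n₃) →
    Improvable F
  exchange-middles F sol {p} {q} q≢p m₁ m₂ m₃ n₁ n₂ n₃ eP eQ x₁₂ x₂₃
    with Chain-split⁀⁀ m₁ m₂ m₃ (chain-of F p eP) | Chain-split⁀⁀ n₁ n₂ n₃ (chain-of F q eQ)
  ... | cm₁ , cm₂ , cm₃ | cn₁ , cn₂ , cn₃ =
    exchange F sol q≢p P′ cp Q′ cq same-edges
      (twice x₁₂ (inj₁ (SamePair-refl , SamePair-refl)) x₂₃ (inj₁ (SamePair-refl , SamePair-refl)))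
      (subst₂ (λ P Q → transitions G P ++ transitions G Q ∼ _) (sym eP) (sym eQ) old)
      new
    where
    u : start m₂ ≡ start n₂
    u = crossAt⇒same-vertex x₁₂
    v : start m₃ ≡ start n₃
    v = crossAt⇒same-vertex x₂₃
    P′ Q′ : List (Dart G)
    P′ = darts m₁ ++ darts n₂ ++ darts m₃
    Q′ = darts n₁ ++ darts m₂ ++ darts n₃
    cp : Chain (source p) P′ (target p)
    cp = Chain-++ (darts m₁) (Chain-resp (darts m₁) refl u cm₁) (Chain-++ (darts n₂) (Chain-resp (darts n₂) refl (sym v) cn₂) cm₃)
    cq : Chain (source q) Q′ (target q)
    cq = Chain-++ (darts n₁) (Chain-resp (darts n₁) refl (sym u) cn₁) (Chain-++ (darts m₂) (Chain-resp (darts m₂) refl v cm₂) cn₃)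
    same-edges : edges P′ ++ edges Q′ ↭ edges (dartsOf F p) ++ edges (dartsOf F q)
    same-edges = subst₂ _↭_
      (sym (cong₂ _++_ (edges-++₃ m₁ n₂ m₃) (edges-++₃ n₁ m₂ n₃)))
      (sym (cong₂ _++_ (trans (cong edges eP) (edges-++₃ m₁ m₂ m₃)) (trans (cong edges eQ) (edges-++₃ n₁ n₂ n₃))))
      (swap-middles (E m₁) (E m₂) (E m₃) (E n₁) (E n₂) (E n₃))
    X : List Transition
    X = (T m₁ ++ T m₂ ++ T m₃) ++ (T n₁ ++ T n₂ ++ T n₃)
    old : T (m₁ ⁀ m₂ ⁀ m₃) ++ T (n₁ ⁀ n₂ ⁀ n₃) ∼ junction m₁ m₂ ∷ junction n₁ n₂ ∷ junction m₂ m₃ ∷ junction n₂ n₃ ∷ X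
    old rewrite transitions-⁀⁀ m₁ m₂ m₃ | transitions-⁀⁀ n₁ n₂ n₃ =
      ↭⇒∼ (pull-junctions₃ (T m₁) (T m₂) (T m₃) (T n₁) (T n₂) (T n₃) _ _ _ _)
    new : T (m₁ ⁀ n₂ ⁀ m₃) ++ T (n₁ ⁀ m₂ ⁀ n₃) ∼ junction m₁ n₂ ∷ junction n₁ m₂ ∷ junction m₂ n₃ ∷ junction n₂ m₃ ∷ X
    new rewrite transitions-⁀⁀ m₁ n₂ m₃ | transitions-⁀⁀ n₁ m₂ n₃ =
      ↭⇒∼ (↭-trans (pull-junctions₃ (T m₁) (T n₂) (T m₃) (T n₁) (T m₂) (T n₃) _ _ _ _)
            (prep _ (prep _ (swap _ _ (swap-middles (T m₁) (T m₂) (T m₃) (T n₁) (T n₂) (T n₃))))))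

  -- As above, with the crossings in opposite orders along q: the swapped segments are reversed.
  exchange-reversed-middles : ∀ F → IsSolution G H F → ∀ {p q} → q ≢ p → ∀ m₁ m₂ m₃ n₁ n₂ n₃ →
    dartsOf F p ≡ darts m₁ ++ darts m₂ ++ darts m₃ → dartsOf F q ≡ darts n₁ ++ darts n₂ ++ darts n₃ →
    CrossAt G Π (junction m₁ m₂) (junction n₂ n₃) → CrossAt G Π (junction m₂ m₃) (junction n₁ n₂) →
    Improvable F
  exchange-reversed-middles F sol {p} {q} q≢p m₁ m₂ m₃ n₁ n₂ n₃ eP eQ x₁₂ x₂₃
    with Chain-split⁀⁀ m₁ m₂ m₃ (chain-of F p eP) | Chain-split⁀⁀ n₁ n₂ n₃ (chain-of F q eQ)
  ... | cm₁ , cm₂ , cm₃ | cn₁ , cn₂ , cn₃ =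
    exchange F sol q≢p P′ cp Q′ cq same-edges
      (twice x₁₂ (inj₂ (inj₁ (refl , first-reverse n₂) , inj₁ (rev-last-reverse m₂ , refl)))
             x₂₃ (inj₂ (inj₂ (refl , first-reverse m₂) , inj₂ (rev-last-reverse n₂ , refl))))
      (subst₂ (λ P Q → transitions G P ++ transitions G Q ∼ _) (sym eP) (sym eQ) old)
      new
    where
    u : start m₂ ≡ start n₃
    u = crossAt⇒same-vertex x₁₂
    v : start m₃ ≡ start n₂
    v = crossAt⇒same-vertex x₂₃
    rn₂ rm₂ : Segment
    rn₂ = reverse n₂
    rm₂ = reverse m₂
    P′ Q′ : List (Dart G)
    P′ = darts m₁ ++ darts rn₂ ++ darts m₃
    Q′ = darts n₁ ++ darts rm₂ ++ darts n₃
    cp : Chain (source p) P′ (target p)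
    cp = Chain-++ (darts m₁) (Chain-resp (darts m₁) refl u cm₁)
           (Chain-++ (darts rn₂) (Chain-resp (darts rn₂) refl (sym v) (Chain-reverse n₂ cn₂)) cm₃)
    cq : Chain (source q) Q′ (target q)
    cq = Chain-++ (darts n₁) (Chain-resp (darts n₁) refl (sym v) cn₁)
           (Chain-++ (darts rm₂) (Chain-resp (darts rm₂) refl u (Chain-reverse m₂ cm₂)) cn₃)
    same-edges : edges P′ ++ edges Q′ ↭ edges (dartsOf F p) ++ edges (dartsOf F q)
    same-edges = subst₂ _↭_
      (sym (cong₂ _++_ (edges-++₃ m₁ rn₂ m₃) (edges-++₃ n₁ rm₂ n₃)))
      (sym (cong₂ _++_ (trans (cong edges eP) (edges-++₃ m₁ m₂ m₃)) (trans (cong edges eQ) (edges-++₃ n₁ n₂ n₃))))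
      (↭-trans (↭.++⁺ (↭.++⁺ˡ (E m₁) (↭.++⁺ʳ (E m₃) (edges-reverse n₂))) (↭.++⁺ˡ (E n₁) (↭.++⁺ʳ (E n₃) (edges-reverse m₂))))
               (swap-middles (E m₁) (E m₂) (E m₃) (E n₁) (E n₂) (E n₃)))
    X : List Transition
    X = (T m₁ ++ T m₂ ++ T m₃) ++ (T n₁ ++ T n₂ ++ T n₃)
    old : T (m₁ ⁀ m₂ ⁀ m₃) ++ T (n₁ ⁀ n₂ ⁀ n₃) ∼ junction m₁ m₂ ∷ junction n₂ n₃ ∷ junction m₂ m₃ ∷ junction n₁ n₂ ∷ X
    old rewrite transitions-⁀⁀ m₁ m₂ m₃ | transitions-⁀⁀ n₁ n₂ n₃ =
      ↭⇒∼ (↭-trans (pull-junctions₃ (T m₁) (T m₂) (T m₃) (T n₁) (T n₂) (T n₃) _ _ _ _)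
            (prep _ (↭-trans (swap _ _ ↭-refl) (↭-trans (prep _ (swap _ _ ↭-refl)) (swap _ _ ↭-refl)))))
    new : T (m₁ ⁀ rn₂ ⁀ m₃) ++ T (n₁ ⁀ rm₂ ⁀ n₃) ∼ junction m₁ rn₂ ∷ junction rm₂ n₃ ∷ junction n₁ rm₂ ∷ junction rn₂ m₃ ∷ X
    new rewrite transitions-⁀⁀ m₁ rn₂ m₃ | transitions-⁀⁀ n₁ rm₂ n₃ =
      ∼-trans (↭⇒∼ (↭-trans (pull-junctions₃ (T m₁) (T rn₂) (T m₃) (T n₁) (T rm₂) (T n₃) _ _ _ _)
                     (prep _ (↭-trans (prep _ (swap _ _ ↭-refl)) (swap _ _ ↭-refl)))))
        (SamePair-refl ∷ SamePair-refl ∷ SamePair-refl ∷ SamePair-refl ∷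
          ∼-trans (∼-++ (∼-++ (∼-refl (T m₁)) (∼-++ (transitions-reverse n₂) (∼-refl (T m₃))))
                        (∼-++ (∼-refl (T n₁)) (∼-++ (transitions-reverse m₂) (∼-refl (T n₃)))))
                  (↭⇒∼ (swap-middles (T m₁) (T m₂) (T m₃) (T n₁) (T n₂) (T n₃))))

  -- With a common target, p and q swap their segments after the crossing.
  exchange-tails : ∀ F → IsSolution G H F → ∀ {p q} → q ≢ p → ∀ m₁ m₂ n₁ n₂ →
    dartsOf F p ≡ darts m₁ ++ darts m₂ → dartsOf F q ≡ darts n₁ ++ darts n₂ →
    CrossAt G Π (junction m₁ m₂) (junction n₁ n₂) → target p ≡ target q → Improvable F
  exchange-tails F sol {p} {q} q≢p m₁ m₂ n₁ n₂ eP eQ x same-target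
    with Chain-split⁀ m₁ m₂ (chain-of F p eP) | Chain-split⁀ n₁ n₂ (chain-of F q eQ)
  ... | cm₁ , cm₂ | cn₁ , cn₂ =
    exchange F sol q≢p P′ cp Q′ cq same-edges (once x (inj₁ (SamePair-refl , SamePair-refl)))
      (subst₂ (λ P Q → transitions G P ++ transitions G Q ∼ _) (sym eP) (sym eQ) old)
      new
    where
    u : start m₂ ≡ start n₂
    u = crossAt⇒same-vertex x
    P′ Q′ : List (Dart G)
    P′ = darts m₁ ++ darts n₂
    Q′ = darts n₁ ++ darts m₂
    cp : Chain (source p) P′ (target p)
    cp = Chain-++ (darts m₁) (Chain-resp (darts m₁) refl u cm₁) (Chain-resp (darts n₂) refl (sym same-target) cn₂)
    cq : Chain (source q) Q′ (target q)
    cq = Chain-++ (darts n₁) (Chain-resp (darts n₁) refl (sym u) cn₁) (Chain-resp (darts m₂) refl same-target cm₂)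
    same-edges : edges P′ ++ edges Q′ ↭ edges (dartsOf F p) ++ edges (dartsOf F q)
    same-edges = subst₂ _↭_
      (sym (cong₂ _++_ (edges-++ m₁ n₂) (edges-++ n₁ m₂)))
      (sym (cong₂ _++_ (trans (cong edges eP) (edges-++ m₁ m₂)) (trans (cong edges eQ) (edges-++ n₁ n₂))))
      (swap-tails (E m₁) (E m₂) (E n₁) (E n₂))
    X : List Transition
    X = (T m₁ ++ T m₂) ++ (T n₁ ++ T n₂)
    old : T (m₁ ⁀ m₂) ++ T (n₁ ⁀ n₂) ∼ junction m₁ m₂ ∷ junction n₁ n₂ ∷ X
    old rewrite transitions-⁀ m₁ m₂ | transitions-⁀ n₁ n₂ = ↭⇒∼ (pull-junctions₂ (T m₁) (T m₂) (T n₁) (T n₂) _ _)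
    new : T (m₁ ⁀ n₂) ++ T (n₁ ⁀ m₂) ∼ junction m₁ n₂ ∷ junction n₁ m₂ ∷ X
    new rewrite transitions-⁀ m₁ n₂ | transitions-⁀ n₁ m₂ =
      ↭⇒∼ (↭-trans (pull-junctions₂ (T m₁) (T n₂) (T n₁) (T m₂) _ _) (prep _ (prep _ (swap-tails (T m₁) (T m₂) (T n₁) (T n₂)))))

  -- With target p = source q, p continues backwards along n₁ and q starts backwards along m₂.
  exchange-reversed : ∀ F → IsSolution G H F → ∀ {p q} → q ≢ p → ∀ m₁ m₂ n₁ n₂ →
    dartsOf F p ≡ darts m₁ ++ darts m₂ → dartsOf F q ≡ darts n₁ ++ darts n₂ →
    CrossAt G Π (junction m₁ m₂) (junction n₁ n₂) → target p ≡ source q → Improvable F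
  exchange-reversed F sol {p} {q} q≢p m₁ m₂ n₁ n₂ eP eQ x target≡source
    with Chain-split⁀ m₁ m₂ (chain-of F p eP) | Chain-split⁀ n₁ n₂ (chain-of F q eQ)
  ... | cm₁ , cm₂ | cn₁ , cn₂ =
    exchange F sol q≢p P′ cp Q′ cq same-edges
      (once x (inj₂ (inj₁ (refl , first-reverse n₁) , inj₁ (rev-last-reverse m₂ , refl))))
      (subst₂ (λ P Q → transitions G P ++ transitions G Q ∼ _) (sym eP) (sym eQ) old)
      new
    where
    u : start m₂ ≡ start n₂
    u = crossAt⇒same-vertex x
    rn₁ rm₂ : Segment
    rn₁ = reverse n₁
    rm₂ = reverse m₂
    P′ Q′ : List (Dart G)
    P′ = darts m₁ ++ darts rn₁
    Q′ = darts rm₂ ++ darts n₂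
    cp : Chain (source p) P′ (target p)
    cp = Chain-++ (darts m₁) (Chain-resp (darts m₁) refl u cm₁)
                  (Chain-resp (darts rn₁) refl (sym target≡source) (Chain-reverse n₁ cn₁))
    cq : Chain (source q) Q′ (target q)
    cq = Chain-++ (darts rm₂) (Chain-resp (darts rm₂) target≡source u (Chain-reverse m₂ cm₂)) cn₂
    same-edges : edges P′ ++ edges Q′ ↭ edges (dartsOf F p) ++ edges (dartsOf F q)
    same-edges = subst₂ _↭_
      (sym (cong₂ _++_ (edges-++ m₁ rn₁) (edges-++ rm₂ n₂)))
      (sym (cong₂ _++_ (trans (cong edges eP) (edges-++ m₁ m₂)) (trans (cong edges eQ) (edges-++ n₁ n₂))))
      (↭-trans (↭.++⁺ (↭.++⁺ˡ (E m₁) (edges-reverse n₁)) (↭.++⁺ʳ (E n₂) (edges-reverse m₂)))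
               (swap-inner (E m₁) (E m₂) (E n₁) (E n₂)))
    X : List Transition
    X = (T m₁ ++ T m₂) ++ (T n₁ ++ T n₂)
    old : T (m₁ ⁀ m₂) ++ T (n₁ ⁀ n₂) ∼ junction m₁ m₂ ∷ junction n₁ n₂ ∷ X
    old rewrite transitions-⁀ m₁ m₂ | transitions-⁀ n₁ n₂ = ↭⇒∼ (pull-junctions₂ (T m₁) (T m₂) (T n₁) (T n₂) _ _)
    new : T (m₁ ⁀ rn₁) ++ T (rm₂ ⁀ n₂) ∼ junction m₁ rn₁ ∷ junction rm₂ n₂ ∷ X
    new rewrite transitions-⁀ m₁ rn₁ | transitions-⁀ rm₂ n₂ =
      ∼-trans (↭⇒∼ (pull-junctions₂ (T m₁) (T rn₁) (T rm₂) (T n₂) _ _))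
        (SamePair-refl ∷ SamePair-refl ∷
          ∼-trans (∼-++ (∼-++ (∼-refl (T m₁)) (transitions-reverse n₁)) (∼-++ (transitions-reverse m₂) (∼-refl (T n₂))))
                  (↭⇒∼ (swap-inner (T m₁) (T m₂) (T n₁) (T n₂))))

module Descent (G : Graph) (Π : PlanarEmbedding G) (H : Demands G) where
  open Crossings G Π
  open Walks G
  open Families G H
  open Improvement G Π H
  open Demands H using (dends)

  PathIdx-∀⊎ : ∀ {P : PathIdx G H → Set} {B : Set} → (∀ p → P p ⊎ B) → (∀ p → P p) ⊎ B
  PathIdx-∀⊎ f with Fin-∀⊎ (λ d → Fin-∀⊎ (λ i → f (d , i)))
  ... | inj₁ all = inj₁ λ (d , i) → all d i
  ... | inj₂ b = inj₂ b

  Crosses : (F : Family G H) (p q : PathIdx G H) →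
    Fin (length (transitions G (dartsOf F p))) → Fin (length (transitions G (dartsOf F q))) → Set
  Crosses F p q i j = CrossAt G Π (lookup (transitions G (dartsOf F p)) i) (lookup (transitions G (dartsOf F q)) j)

  NicePair : Family G H → PathIdx G H → PathIdx G H → Set
  NicePair F p q = p ≢ q →
    CrossAtMostOnce G Π (F p) (F q) × (SamePair (dends (proj₁ p)) (dends (proj₁ q)) → NoCross G Π (F p) (F q))

  private
    -- If t crosses two transitions of r, then r passes twice through the vertex of t.
    revisit⇒improvable : ∀ F → IsSolution G H F → ∀ r {i i′} → toℕ i < toℕ i′ → ∀ {t} →
      CrossAt G Π t (lookup (transitions G (dartsOf F r)) i) → CrossAt G Π t (lookup (transitions G (dartsOf F r)) i′) →
      Improvable F
    revisit⇒improvable F sol r {i} {i′} i<i′ {t} x x′ with cut-at₂ (dartsOf F r) i i′ i<i′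
    ... | m₁ , m₂ , m₃ , eq , tᵢ , tᵢ′ = shortcut F sol r m₁ m₂ m₃ eq (begin
      start m₂                                                  ≡⟨ cong (tail G ∘ proj₂) (sym tᵢ) ⟩
      tail G (proj₂ (lookup (transitions G (dartsOf F r)) i))  ≡⟨ sym (crossAt⇒same-vertex x) ⟩
      tail G (proj₂ t)                                          ≡⟨ crossAt⇒same-vertex x′ ⟩
      tail G (proj₂ (lookup (transitions G (dartsOf F r)) i′)) ≡⟨ cong (tail G ∘ proj₂) tᵢ′ ⟩
      start m₃                                                  ∎)
      where open ≡-Reasoning

    cross-twice⇒improvable : ∀ F → IsSolution G H F → ∀ {p q} → q ≢ p → ∀ {i i′ j j′} → toℕ i < toℕ i′ → j ≢ j′ →
      Crosses F p q i j → Crosses F p q i′ j′ → Improvable F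
    cross-twice⇒improvable F sol {p} {q} q≢p {i} {i′} {j} {j′} i<i′ j≢j′ x x′
      with cut-at₂ (dartsOf F p) i i′ i<i′ | Fin-<-or-> j≢j′
    ... | m₁ , m₂ , m₃ , eP , tᵢ , tᵢ′ | inj₁ j<j′ with cut-at₂ (dartsOf F q) j j′ j<j′
    ...   | n₁ , n₂ , n₃ , eQ , tⱼ , tⱼ′ =
      exchange-middles F sol q≢p m₁ m₂ m₃ n₁ n₂ n₃ eP eQ (subst₂ (CrossAt G Π) tᵢ tⱼ x) (subst₂ (CrossAt G Π) tᵢ′ tⱼ′ x′)
    cross-twice⇒improvable F sol {p} {q} q≢p {i} {i′} {j} {j′} i<i′ j≢j′ x x′
      | m₁ , m₂ , m₃ , eP , tᵢ , tᵢ′ | inj₂ j′<j with cut-at₂ (dartsOf F q) j′ j j′<j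
    ...   | n₁ , n₂ , n₃ , eQ , tⱼ′ , tⱼ =
      exchange-reversed-middles F sol q≢p m₁ m₂ m₃ n₁ n₂ n₃ eP eQ (subst₂ (CrossAt G Π) tᵢ tⱼ x) (subst₂ (CrossAt G Π) tᵢ′ tⱼ′ x′)

    two-crossings⇒improvable : ∀ F → IsSolution G H F → ∀ {p q} → q ≢ p → ∀ {i i′ j j′} →
      Crosses F p q i j → Crosses F p q i′ j′ → ¬ (i ≡ i′ × j ≡ j′) → Improvable F
    two-crossings⇒improvable F sol {p} {q} q≢p {i} {i′} {j} {j′} x x′ differ with i ≟ᶠ i′ | j ≟ᶠ j′
    ... | yes i≡i′ | yes j≡j′ = ⊥-elim (differ (i≡i′ , j≡j′))
    ... | yes refl | no j≢j′ with Fin-<-or-> j≢j′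
    ...   | inj₁ j<j′ = revisit⇒improvable F sol q j<j′ x x′
    ...   | inj₂ j′<j = revisit⇒improvable F sol q j′<j x′ x
    two-crossings⇒improvable F sol {p} {q} q≢p {i} {i′} {j} {j′} x x′ differ | no i≢i′ | yes refl with Fin-<-or-> i≢i′
    ...   | inj₁ i<i′ = revisit⇒improvable F sol p i<i′ (crossAt-sym x) (crossAt-sym x′)
    ...   | inj₂ i′<i = revisit⇒improvable F sol p i′<i (crossAt-sym x′) (crossAt-sym x)
    two-crossings⇒improvable F sol {p} {q} q≢p {i} {i′} {j} {j′} x x′ differ | no i≢i′ | no j≢j′ with Fin-<-or-> i≢i′
    ...   | inj₁ i<i′ = cross-twice⇒improvable F sol q≢p i<i′ j≢j′ x x′
    ...   | inj₂ i′<i = cross-twice⇒improvable F sol q≢p i′<i (j≢j′ ∘ sym) x′ x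

    crossing-same-ends⇒improvable : ∀ F → IsSolution G H F → ∀ {p q} → q ≢ p →
      SamePair (dends (proj₁ p)) (dends (proj₁ q)) → ∀ {i j} → Crosses F p q i j → Improvable F
    crossing-same-ends⇒improvable F sol {p} {q} q≢p same {i} {j} x
      with cut-at (dartsOf F p) i | cut-at (dartsOf F q) j | same
    ... | m₁ , m₂ , eP , _ , tᵢ | n₁ , n₂ , eQ , _ , tⱼ | inj₁ (_ , same-target) =
      exchange-tails F sol q≢p m₁ m₂ n₁ n₂ eP eQ (subst₂ (CrossAt G Π) tᵢ tⱼ x) same-target
    ... | m₁ , m₂ , eP , _ , tᵢ | n₁ , n₂ , eQ , _ , tⱼ | inj₂ (_ , target≡source) =
      exchange-reversed F sol q≢p m₁ m₂ n₁ n₂ eP eQ (subst₂ (CrossAt G Π) tᵢ tⱼ x) target≡source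

  private
    at-most-once-or-improvable : ∀ F → IsSolution G H F → ∀ p q → q ≢ p → CrossAtMostOnce G Π (F p) (F q) ⊎ Improvable F
    at-most-once-or-improvable F sol p q q≢p = Fin-∀⊎ λ i → Fin-∀⊎ λ i′ → Fin-∀⊎ λ j → Fin-∀⊎ λ j′ → check i i′ j j′
      where
      check : ∀ i i′ j j′ → (Crosses F p q i j → Crosses F p q i′ j′ → i ≡ i′ × j ≡ j′) ⊎ Improvable F
      check i i′ j j′ with crossAt? (lookup (transitions G (dartsOf F p)) i) (lookup (transitions G (dartsOf F q)) j)
                         | crossAt? (lookup (transitions G (dartsOf F p)) i′) (lookup (transitions G (dartsOf F q)) j′)
                         | i ≟ᶠ i′ ×-dec j ≟ᶠ j′
      ... | _      | _       | yes same   = inj₁ λ _ _ → same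
      ... | yes x  | yes x′  | no differ  = inj₂ (two-crossings⇒improvable F sol q≢p x x′ differ)
      ... | no ¬x  | _       | no _       = inj₁ λ x → ⊥-elim (¬x x)
      ... | yes _  | no ¬x′  | no _       = inj₁ λ _ x′ → ⊥-elim (¬x′ x′)

    no-crossing-or-improvable : ∀ F → IsSolution G H F → ∀ p q → q ≢ p →
      SamePair (dends (proj₁ p)) (dends (proj₁ q)) → NoCross G Π (F p) (F q) ⊎ Improvable F
    no-crossing-or-improvable F sol p q q≢p same = Fin-∀⊎ λ i → Fin-∀⊎ λ j → check i j
      where
      check : ∀ i j → ¬ Crosses F p q i j ⊎ Improvable F
      check i j with crossAt? (lookup (transitions G (dartsOf F p)) i) (lookup (transitions G (dartsOf F q)) j)
      ... | yes x = inj₂ (crossing-same-ends⇒improvable F sol q≢p same x)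
      ... | no ¬x = inj₁ ¬x

    SamePair? : ∀ (x y : Fin (Graph.nV G) × Fin (Graph.nV G)) → Dec (SamePair x y)
    SamePair? (x , y) (a , b) = (x ≟ᶠ a ×-dec y ≟ᶠ b) ⊎-dec (x ≟ᶠ b ×-dec y ≟ᶠ a)

  pair-nice-or-improvable : ∀ F → IsSolution G H F → ∀ p q → NicePair F p q ⊎ Improvable F
  pair-nice-or-improvable F sol p q with p ≟ⁱ q
  ... | yes refl = inj₁ (λ p≢p → ⊥-elim (p≢p refl))
  ... | no p≢q with at-most-once-or-improvable F sol p q (p≢q ∘ sym) | SamePair? (dends (proj₁ p)) (dends (proj₁ q))
  ...   | inj₂ better | _ = inj₂ better
  ...   | inj₁ crosses-once | no ¬same = inj₁ λ _ → crosses-once , λ same → ⊥-elim (¬same same)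
  ...   | inj₁ crosses-once | yes same with no-crossing-or-improvable F sol p q (p≢q ∘ sym) same
  ...     | inj₁ none = inj₁ λ _ → crosses-once , λ _ → none
  ...     | inj₂ better = inj₂ better

  nice-or-improvable : ∀ F → IsSolution G H F → (∀ p q → NicePair F p q) ⊎ Improvable F
  nice-or-improvable F sol = PathIdx-∀⊎ λ p → PathIdx-∀⊎ λ q → pair-nice-or-improvable F sol p q

  solution⇒nice-solution : ∀ F → IsSolution G H F → HasNiceSolution G H Π
  solution⇒nice-solution = WF.All.wfRec (On.wellFounded measure (×-wellFounded <-wellFounded <-wellFounded)) _
    (λ F → IsSolution G H F → HasNiceSolution G H Π) step
    where
    step : ∀ F → WfRec _≺_ (λ F → IsSolution G H F → HasNiceSolution G H Π) F → IsSolution G H F → HasNiceSolution G H Π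
    step F rec sol with nice-or-improvable F sol
    ... | inj₁ nice = F , sol , nice
    ... | inj₂ (F′ , sol′ , F′≺F) = rec F′≺F sol′

lemma1 : (G : Graph) (Π : PlanarEmbedding G) (H : Demands G) →
    HasSolution G H ⇔ HasNiceSolution G H Π
lemma1 G Π H = mk⇔ (λ (F , sol) → solution⇒nice-solution F sol) (λ (F , sol , _) → F , sol)
  where open Descent G Π H
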